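{- Let $G\le S_X$ be transitive with a normal block system $\mathcal B$, let $N=\mathrm{fix}_G(\mathcal B)$ and fix $B_0\in\mathcal B$. Suppose $T=\mathsf{Soc}(N^{B_0})$ is a transitive nonabelian simple group. Then: (1) $\mathsf{Soc}(N)=T_1\times\cdots\times T_k$ where each $T_i\cong T$, and the sets $C_i=\mathrm{supp}(T_i)$, $1\le i\le k$, form a block system $\mathcal C$ of $G$ with $\mathcal B\preceq\mathcal C$; (2) for every $i$ and every block $B\in\mathcal B$ contained in $C_i$, the pointwise stabilisers satisfy $N_B=N_{C_i}$, and $N_{C_i}\cap T_i=1$; (3) if $\mathsf{Soc}(N)$ contains two isomorphic semiregular subgroups $U$ and $V$, and any two semiregular subgroups of $T$ isomorphic to $U^{B_0}$ are conjugate in $T$, then there exists $\delta\in\mathrm{fix}_G(\mathcal B)$ such that $\mathsf{Orb}(U,X)=\mathsf{Orb}(\delta^{ -1}V\delta,X)$; (4) an element $g\in N$ belongs to $\mathsf{Soc}(N)$ if and only if $g^B\in\mathsf{Soc}(N^B)$ for every $B\in\mathcal B$.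
   Context: A block system of a transitive $G\le S_X$ is a partition of $X$ into blocks (nonempty $B$ with $g(B)=B$ or $g(B)\cap B=\emptyset$ for all $g\in G$) permuted by $G$; it is normal if it is the set of orbits of a normal subgroup of $G$. $\mathrm{fix}_G(\mathcal B)=\{g\in G: g(B)=B\ \forall B\in\mathcal B\}$. For $H$ stabilising $B$ setwise, $H^B$ is the induced permutation group on $B$, and $g^B$ the induced permutation. $\mathsf{Soc}$ denotes the socle (subgroup generated by all minimal normal subgroups). $\mathrm{supp}(H)$ is the set of points moved by some element of $H$. $H_Y$ is the pointwise stabiliser of $Y$. $\mathsf{Orb}(H,X)$ is the set of $H$-orbits on $X$. $\mathcal B\preceq\mathcal C$ means every block of $\mathcal B$ is contained in a block of $\mathcal C$. -}

module Defs where

-- A "group" here is a set of permutations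
-- (a predicate on permutations) closed under the group operations.

open import Level using (Level; _⊔_) renaming (zero to lzero; suc to lsuc)
open import Data.Nat using (ℕ; zero; suc)
open import Data.Fin using (Fin)
open import Data.Product using (Σ; Σ-syntax; ∃; _×_; _,_; proj₁; proj₂)
open import Data.Sum using (_⊎_)
open import Relation.Nullary using (¬_)
open import Relation.Binary.PropositionalEquality using (_≡_; _≢_; refl; trans; cong)

private
  variable
    ℓ ℓ' : Level

_iff_ : ∀ {a b} → Set a → Set b → Set (a ⊔ b)
P iff Q = (P → Q) × (Q → P)

record Perm (A : Set) : Set where
  constructor mkPerm
  field
    to      : A → A
    from    : A → A
    from-to : ∀ x → from (to x) ≡ x
    to-from : ∀ x → to (from x) ≡ x
open Perm public

module _ {A : Set} where

  idP : Perm A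
  idP = mkPerm (λ x → x) (λ x → x) (λ _ → refl) (λ _ → refl)

  _∘P_ : Perm A → Perm A → Perm A
  g ∘P h = mkPerm (λ x → to g (to h x)) (λ x → from h (from g x))
    (λ x → trans (cong (from h) (from-to g (to h x))) (from-to h x))
    (λ x → trans (cong (to g) (to-from h (from g x))) (to-from g x))

  invP : Perm A → Perm A
  invP g = mkPerm (from g) (to g) (to-from g) (from-to g)

  _≈P_ : Perm A → Perm A → Set
  g ≈P h = ∀ x → to g x ≡ to h x

PSet : Set → (ℓ : Level) → Set (lsuc ℓ)
PSet A ℓ = Perm A → Set ℓ

module _ {A : Set} where

  record IsSubgroup (H : PSet A ℓ) : Set ℓ where
    field
      resp       : ∀ {g h} → g ≈P h → H g → H h
      has-id     : H idP
      closed-∘   : ∀ {g h} → H g → H h → H (g ∘P h)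
      closed-inv : ∀ {g} → H g → H (invP g)

  _⊆_ : PSet A ℓ → PSet A ℓ' → Set (ℓ ⊔ ℓ')
  H ⊆ K = ∀ g → H g → K g

  SameSet : PSet A ℓ → PSet A ℓ' → Set (ℓ ⊔ ℓ')
  SameSet H K = (H ⊆ K) × (K ⊆ H)

  IsNormal : PSet A ℓ → PSet A ℓ' → Set (ℓ ⊔ ℓ')
  IsNormal H K = IsSubgroup H × (H ⊆ K)
    × (∀ k h → K k → H h → H ((k ∘P h) ∘P invP k))

  Trivial : PSet A ℓ → Set ℓ
  Trivial H = ∀ g → H g → g ≈P idP

  NonTrivial : PSet A ℓ → Set ℓ
  NonTrivial H = Σ[ g ∈ Perm A ] (H g × ¬ (g ≈P idP))

  MinimalNormal : PSet A lzero → PSet A ℓ → Set (lsuc lzero ⊔ ℓ)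
  MinimalNormal M H = IsNormal M H × NonTrivial M
    × (∀ (K : PSet A lzero) → IsNormal K H → K ⊆ M → Trivial K ⊎ (M ⊆ K))

  data Gen (S : PSet A ℓ) : PSet A ℓ where
    gen  : ∀ {g} → S g → Gen S g
    gid  : Gen S idP
    gmul : ∀ {g h} → Gen S g → Gen S h → Gen S (g ∘P h)
    ginv : ∀ {g} → Gen S g → Gen S (invP g)
    gres : ∀ {g h} → g ≈P h → Gen S g → Gen S h

  Soc : PSet A ℓ → PSet A (lsuc lzero ⊔ ℓ)
  Soc H = Gen (λ g → Σ[ M ∈ PSet A lzero ] (MinimalNormal M H × M g))

  Simple : PSet A ℓ → Set (lsuc lzero ⊔ ℓ)
  Simple T = IsSubgroup T × NonTrivial T
    × (∀ (K : PSet A lzero) → IsNormal K T → Trivial K ⊎ (T ⊆ K))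

  NonAbelian : PSet A ℓ → Set ℓ
  NonAbelian T = Σ[ a ∈ Perm A ] Σ[ b ∈ Perm A ]
    (T a × T b × ¬ ((a ∘P b) ≈P (b ∘P a)))

  Transitive : PSet A ℓ → Set ℓ
  Transitive H = ∀ x y → Σ[ g ∈ Perm A ] (H g × to g x ≡ y)

  Semiregular : PSet A ℓ → Set ℓ
  Semiregular H = ∀ h x → H h → to h x ≡ x → h ≈P idP

  supp : PSet A ℓ → A → Set ℓ
  supp H x = Σ[ h ∈ Perm A ] (H h × ¬ (to h x ≡ x))

  PtStab : PSet A ℓ → (A → Set ℓ') → PSet A (ℓ ⊔ ℓ')
  PtStab H Y g = H g × (∀ y → Y y → to g y ≡ y)

  ConjugateIn : PSet A ℓ → PSet A lzero → PSet A lzero → Set ℓ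
  ConjugateIn T W₁ W₂ = Σ[ t ∈ Perm A ] (T t ×
    SameSet W₂ (λ w → Σ[ w₁ ∈ Perm A ] (W₁ w₁ × w ≈P ((t ∘P w₁) ∘P invP t))))

  prodP : ∀ {k} → (Fin k → Perm A) → Perm A
  prodP {zero}  t = idP
  prodP {suc k} t = t Fin.zero ∘P prodP (λ i → t (Fin.suc i))
    where import Data.Fin as Fin

  InternalDirectProduct : ∀ {k} → PSet A ℓ → (Fin k → PSet A ℓ') → Set (ℓ ⊔ ℓ')
  InternalDirectProduct {k = k} S Ts =
      (∀ i → IsSubgroup (Ts i))
    × (∀ i → Ts i ⊆ S)
    × (∀ i j → i ≢ j → ∀ a b → Ts i a → Ts j b → (a ∘P b) ≈P (b ∘P a))
    × (∀ g → S g → Σ[ t ∈ (Fin k → Perm A) ] ((∀ i → Ts i (t i)) × prodP t ≈P g))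
    × (∀ (t t' : Fin k → Perm A) → (∀ i → Ts i (t i)) → (∀ i → Ts i (t' i))
         → prodP t ≈P prodP t' → ∀ i → t i ≈P t' i)

record Iso {A B : Set} (H : PSet A ℓ) (K : PSet B ℓ') : Set (ℓ ⊔ ℓ') where
  field
    φ      : (g : Perm A) → H g → Perm B
    φ-mem  : ∀ g p → K (φ g p)
    φ-resp : ∀ g g' p p' → g ≈P g' → φ g p ≈P φ g' p'
    φ-hom  : ∀ g h p q r → φ (g ∘P h) r ≈P (φ g p ∘P φ h q)
    φ-inj  : ∀ g h p q → φ g p ≈P φ h q → g ≈P h
    φ-surj : ∀ k → K k → Σ[ g ∈ Perm A ] Σ[ p ∈ H g ] (φ g p ≈P k)

-- Block systems on X = Fin n, encoded by a labelling β : Fin n → Fin n;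
-- the blocks are the nonempty fibres of β (x, y in the same block iff
-- β x ≡ β y).  Every partition of Fin n arises this way.

module _ {n : ℕ} where

  IsBlockSystem : PSet (Fin n) ℓ → (Fin n → Fin n) → Set ℓ
  IsBlockSystem G β = ∀ g → G g → ∀ x y → β x ≡ β y → β (to g x) ≡ β (to g y)

  IsNormalBlockSystem : PSet (Fin n) ℓ → (Fin n → Fin n) → Set (lsuc lzero ⊔ ℓ)
  IsNormalBlockSystem G β = IsBlockSystem G β
    × Σ[ M ∈ PSet (Fin n) lzero ] (IsNormal M G
        × (∀ x y → (β x ≡ β y) iff (Σ[ m ∈ Perm (Fin n) ] (M m × to m x ≡ y))))

  Fix : PSet (Fin n) ℓ → (Fin n → Fin n) → PSet (Fin n) ℓ
  Fix G β g = G g × (∀ x → β (to g x) ≡ β x)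

  Blk : (Fin n → Fin n) → Fin n → Set
  Blk β b = Σ[ y ∈ Fin n ] (β y ≡ β b)

  Restricts : (β : Fin n → Fin n) (b : Fin n) → Perm (Fin n) → Perm (Blk β b) → Set
  Restricts β b g σ = ∀ (y : Blk β b) → proj₁ (to σ y) ≡ to g (proj₁ y)

  -- the induced group H^B on the block B of b (H stabilising B)
  Induced : PSet (Fin n) ℓ → (β : Fin n → Fin n) (b : Fin n) → PSet (Blk β b) ℓ
  Induced H β b σ = Σ[ g ∈ Perm (Fin n) ] (H g × Restricts β b g σ)

  IsIndexedBlockSystem : ∀ {k} → PSet (Fin n) ℓ → (Fin k → Fin n → Set ℓ') → Set (ℓ ⊔ ℓ')
  IsIndexedBlockSystem {k = k} G C =
      (∀ i → Σ[ x ∈ Fin n ] C i x)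
    × (∀ x → Σ[ i ∈ Fin k ] (C i x × (∀ j → C j x → j ≡ i)))
    × (∀ g → G g → ∀ i → Σ[ j ∈ Fin k ] (∀ x → C i x iff C j (to g x)))

  Refines : ∀ {k} → (Fin n → Fin n) → (Fin k → Fin n → Set ℓ') → Set ℓ'
  Refines {k = k} β C = ∀ (i : Fin k) x y → β x ≡ β y → C i x → C i y

module Submission where

-- Simplicity of T is a statement about arbitrary predicates, so it yields excluded middle and the
-- classical finite arguments apply.  The core fact: a minimal normal subgroup M of N that
-- moves a point of a block B has restriction to B containing Soc(N^B) ≅ T (conjugate B to B₀ inside
-- the transitive group G); as T is nonabelian, every element of N centralising M fixes B pointwise.
-- Hence minimal normal subgroups of N active on a common block coincide, each is supported on a union
-- of blocks, and their supports partition X.  These subgroups are the direct factors Tᵢ of Soc N; G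
-- permutes them, and restricting a conjugate of Tᵢ to B₀ is an isomorphism onto T.  An element of N
-- lies in Soc N iff it agrees on each supp Tᵢ with an element of Tᵢ, which is detected block by block.
-- For (3), the projections of U and V to each Tᵢ become semiregular subgroups of T isomorphic to U^B₀,
-- hence conjugate by some τ ∈ T; lifting τ to dᵢ ∈ Tᵢ, the product δ of the dᵢ matches the orbits.

open import Defs
open import Level using (Level; _⊔_; Lift; lift; lower) renaming (zero to lzero; suc to lsuc)
open import Data.Nat using (ℕ; zero; suc; _<_; _≤_; s≤s; z≤n)
import Data.Nat.Properties as ℕ
open import Data.Fin using (Fin) renaming (zero to fzero; suc to fsuc)
import Data.Fin.Properties as Fin
open import Data.Product using (Σ-syntax; _×_; _,_; proj₁; proj₂)
open import Data.Sum using (_⊎_; inj₁; inj₂)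
open import Data.Empty using (⊥-elim)
open import Function using (_∘_)
open import Data.List using (List; []; _∷_; length; map; concatMap; lookup; allFin)
open import Data.List.Properties using (length-map; ∷-injective)
open import Data.List.Membership.Propositional using (_∈_)
open import Data.List.Membership.Propositional.Properties using (∈-map⁺; ∈-concatMap⁺; ∈-allFin)
open import Data.List.Relation.Unary.Any as Any using (Any; here; there; any?)
open import Data.List.Relation.Unary.Any.Properties using (lookup-index)
open import Data.List.Relation.Unary.All as All using (All; []; _∷_; all?)
open import Data.List.Relation.Unary.AllPairs using (AllPairs; []; _∷_)
open import Relation.Nullary using (¬_; Dec; yes; no)
open import Relation.Nullary.Decidable using (map′; decidable-stable)
open import Relation.Unary using (_∩_)
open import Relation.Binary.Definitions using (DecidableEquality)
open import Relation.Binary.PropositionalEquality using (_≡_; _≢_; refl; sym; trans; cong; subst)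
open import Axiom.ExcludedMiddle using (ExcludedMiddle)
open import Axiom.UniquenessOfIdentityProofs using (module Decidable⇒UIP)

private
  variable
    ℓ ℓ' : Level

module _ {A : Set} where

  ∘P-cong : {g g' h h' : Perm A} → g ≈P g' → h ≈P h' → (g ∘P h) ≈P (g' ∘P h')
  ∘P-cong {g} {h' = h'} e e' x = trans (cong (to g) (e' x)) (e (to h' x))

  invP-cong : {g g' : Perm A} → g ≈P g' → invP g ≈P invP g'
  invP-cong {g} {g'} e x = trans (cong (from g) (sym (to-from g' x)))
    (trans (cong (from g) (sym (e (from g' x)))) (from-to g (from g' x)))

  to-injective : (g : Perm A) {x y : A} → to g x ≡ to g y → x ≡ y
  to-injective g {x} {y} e = trans (sym (from-to g x)) (trans (cong (from g) e) (from-to g y))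

  from-fixed : (g : Perm A) {x : A} → to g x ≡ x → from g x ≡ x
  from-fixed g {x} e = trans (cong (from g) (sym e)) (from-to g x)

  conj : Perm A → Perm A → Perm A
  conj k h = (k ∘P h) ∘P invP k

  conj-∘P : (h a b : Perm A) → conj h (a ∘P b) ≈P (conj h a ∘P conj h b)
  conj-∘P h a b x = cong (λ z → to h (to a z)) (sym (from-to h (to b (from h x))))

  conj-invP-cancel : (h k : Perm A) → conj h (conj (invP h) k) ≈P k
  conj-invP-cancel h k x = trans (to-from h _) (cong (to k) (to-from h x))

  invP-conj-cancel : (h k : Perm A) → conj (invP h) (conj h k) ≈P k
  invP-conj-cancel h k x = trans (from-to h _) (cong (to k) (from-to h x))

  conj≈id⇒≈id : (h g : Perm A) → conj h g ≈P idP → g ≈P idP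
  conj≈id⇒≈id h g e x =
    to-injective h (trans (cong (λ z → to h (to g z)) (sym (from-to h x))) (e (to h x)))

  comm : Perm A → Perm A → Perm A
  comm a b = conj a b ∘P invP b

  comm≈id⇒commute : (a b : Perm A) → comm a b ≈P idP → (a ∘P b) ≈P (b ∘P a)
  comm≈id⇒commute a b e x = trans (sym (cong (λ z → to a (to b z)) (from-to a x)))
    (trans (sym (cong (λ z → to a (to b (from a z))) (from-to b (to a x)))) (e (to b (to a x))))

module _ {A : Set} {H : PSet A ℓ} (H≤ : IsSubgroup H) where
  open IsSubgroup H≤

  conj-closed : ∀ {k h} → H k → H h → H (conj k h)
  conj-closed k∈H h∈H = closed-∘ (closed-∘ k∈H h∈H) (closed-inv k∈H)

  prodP-closed : ∀ {m} (t : Fin m → Perm A) → (∀ i → H (t i)) → H (prodP t)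
  prodP-closed {zero}  t t∈H = has-id
  prodP-closed {suc m} t t∈H = closed-∘ (t∈H fzero) (prodP-closed (λ i → t (fsuc i)) (λ i → t∈H (fsuc i)))

module _ {A : Set} {M : PSet A ℓ} {H : PSet A ℓ'} (M⊴H : IsNormal M H) where

  normal⇒subgroup : IsSubgroup M
  normal⇒subgroup = proj₁ M⊴H

  normal⇒⊆ : M ⊆ H
  normal⇒⊆ = proj₁ (proj₂ M⊴H)

  normal-conj : ∀ {k m} → H k → M m → M (conj k m)
  normal-conj {k} {m} = proj₂ (proj₂ M⊴H) k m

  normal-commˡ : ∀ {a b} → H a → M b → M (comm a b)
  normal-commˡ a∈H b∈M = IsSubgroup.closed-∘ normal⇒subgroup (normal-conj a∈H b∈M)
    (IsSubgroup.closed-inv normal⇒subgroup b∈M)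

  normal-commʳ : ∀ {a b} → M a → H b → M (comm a b)
  normal-commʳ a∈M b∈H = IsSubgroup.resp normal⇒subgroup (λ _ → refl)
    (IsSubgroup.closed-∘ normal⇒subgroup a∈M (normal-conj b∈H (IsSubgroup.closed-inv normal⇒subgroup a∈M)))

module _ {A : Set} {M M' : PSet A lzero} {H : PSet A ℓ} where

  ∩-normal : IsNormal M H → IsNormal M' H → IsNormal (M ∩ M') H
  ∩-normal M⊴H M'⊴H =
      record
        { resp       = λ e (m , m') → S.resp e m , S'.resp e m'
        ; has-id     = S.has-id , S'.has-id
        ; closed-∘   = λ (a , a') (b , b') → S.closed-∘ a b , S'.closed-∘ a' b'
        ; closed-inv = λ (a , a') → S.closed-inv a , S'.closed-inv a'
        }
    , (λ g (m , _) → normal⇒⊆ M⊴H g m)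
    , λ k h k∈H (m , m') → normal-conj M⊴H k∈H m , normal-conj M'⊴H k∈H m'
    where
      module S  = IsSubgroup (normal⇒subgroup M⊴H)
      module S' = IsSubgroup (normal⇒subgroup M'⊴H)

  disjoint-normal⇒comm≈id : IsNormal M H → IsNormal M' H → Trivial (M ∩ M') →
    ∀ {a b} → M a → M' b → comm a b ≈P idP
  disjoint-normal⇒comm≈id M⊴H M'⊴H M∩M'≈1 {a} {b} a∈M b∈M' =
    M∩M'≈1 (comm a b) (normal-commʳ M⊴H a∈M (normal⇒⊆ M'⊴H b b∈M')
        , normal-commˡ M'⊴H (normal⇒⊆ M⊴H a a∈M) b∈M')

module _ {A : Set} {S : PSet A ℓ} where

  Gen-isSubgroup : IsSubgroup (Gen S)
  Gen-isSubgroup = record { resp = gres ; has-id = gid ; closed-∘ = gmul ; closed-inv = ginv }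

  Gen-least : {K : PSet A ℓ'} → IsSubgroup K → S ⊆ K → Gen S ⊆ K
  Gen-least K≤ S⊆K _ (gen s)    = S⊆K _ s
  Gen-least K≤ S⊆K _ gid        = IsSubgroup.has-id K≤
  Gen-least K≤ S⊆K _ (gmul a b) = IsSubgroup.closed-∘ K≤ (Gen-least K≤ S⊆K _ a) (Gen-least K≤ S⊆K _ b)
  Gen-least K≤ S⊆K _ (ginv a)   = IsSubgroup.closed-inv K≤ (Gen-least K≤ S⊆K _ a)
  Gen-least K≤ S⊆K _ (gres e a) = IsSubgroup.resp K≤ e (Gen-least K≤ S⊆K _ a)

  Gen-conj-closed : (k : Perm A) → (∀ {g} → S g → S (conj k g)) → ∀ {g} → Gen S g → Gen S (conj k g)
  Gen-conj-closed k S-closed (gen s)              = gen (S-closed s)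
  Gen-conj-closed k S-closed gid                  = gres (λ y → sym (to-from k y)) gid
  Gen-conj-closed k S-closed (gmul {a} {b} p q)   =
    gres (λ y → sym (conj-∘P k a b y)) (gmul (Gen-conj-closed k S-closed p) (Gen-conj-closed k S-closed q))
  Gen-conj-closed k S-closed (ginv p)             = gres (λ _ → refl) (ginv (Gen-conj-closed k S-closed p))
  Gen-conj-closed k S-closed (gres {a} {b} e p)   = gres (λ y → cong (to k) (e (from k y))) (Gen-conj-closed k S-closed p)

Lift-isSubgroup : {A : Set} {H : PSet A ℓ} → IsSubgroup H → IsSubgroup (λ g → Lift ℓ' (H g))
Lift-isSubgroup H≤ = record
  { resp       = λ e (lift g∈H) → lift (resp e g∈H)
  ; has-id     = lift has-id
  ; closed-∘   = λ (lift g∈H) (lift h∈H) → lift (closed-∘ g∈H h∈H)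
  ; closed-inv = λ (lift g∈H) → lift (closed-inv g∈H)
  }
  where open IsSubgroup H≤

Soc⊆ : {A : Set} {H : PSet A ℓ} → IsSubgroup H → Soc H ⊆ H
Soc⊆ H≤ = Gen-least H≤ λ g (M , M-min , g∈M) → normal⇒⊆ (proj₁ M-min) g g∈M

supp-mono : {A : Set} {M : PSet A ℓ} {M' : PSet A ℓ'} → M ⊆ M' → ∀ {x} → supp M x → supp M' x
supp-mono M⊆M' (m , m∈M , mx≢x) = m , M⊆M' m m∈M , mx≢x

module _ {A : Set} (_≟_ : DecidableEquality A) where

  supp-closed : {M : PSet A ℓ} → IsSubgroup M → ∀ {m} → M m → ∀ {x} → supp M x → supp M (to m x)
  supp-closed {M = M} M≤ {m} m∈M {x} x∈supp with to m x ≟ x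
  ... | yes mx≡x = subst (supp M) (sym mx≡x) x∈supp
  ... | no mx≢x  = invP m , IsSubgroup.closed-inv M≤ m∈M , λ e → mx≢x (sym (trans (sym (from-to m x)) e))

  ¬supp⇒fixed : {M : PSet A ℓ} → ∀ {m} → M m → ∀ {x} → ¬ supp M x → to m x ≡ x
  ¬supp⇒fixed m∈M x∉supp = decidable-stable (_ ≟ _) λ mx≢x → x∉supp (_ , m∈M , mx≢x)

  disjointSupp⇒commute : {M : PSet A ℓ} {M' : PSet A ℓ'} → IsSubgroup M → IsSubgroup M' →
    (∀ {x} → supp M x → ¬ supp M' x) → ∀ {a b} → M a → M' b → (a ∘P b) ≈P (b ∘P a)
  disjointSupp⇒commute M≤ M'≤ disjoint {a} {b} a∈M b∈M' x with to a x ≟ x | to b x ≟ x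
  ... | no ax≢x | _ =
    trans (cong (to a) (¬supp⇒fixed b∈M' (disjoint x∈supp)))
          (sym (¬supp⇒fixed b∈M' (disjoint (supp-closed M≤ a∈M x∈supp))))
    where x∈supp = a , a∈M , ax≢x
  ... | yes ax≡x | no bx≢x =
    trans (¬supp⇒fixed a∈M λ s → disjoint s (supp-closed M'≤ b∈M' (b , b∈M' , bx≢x))) (cong (to b) (sym ax≡x))
  ... | yes ax≡x | yes bx≡x = trans (cong (to a) bx≡x) (trans ax≡x (sym (trans (cong (to b) ax≡x) bx≡x)))

module _ {A : Set} (S : A → Set) where

  AgreeOn : Perm A → Perm A → Set
  AgreeOn g h = ∀ x → S x → to g x ≡ to h x

  AgreeOn-∘P : ∀ {m m' g g'} → (∀ {x} → S x → S (to m' x)) →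
      AgreeOn m g → AgreeOn m' g' → AgreeOn (m ∘P m') (g ∘P g')
  AgreeOn-∘P {g = g} m'-closed agree agree' x s = trans (agree _ (m'-closed s)) (cong (to g) (agree' x s))

  AgreeOn-invP : ∀ {m g} → (∀ {x} → S x → S (from m x)) → AgreeOn m g → AgreeOn (invP m) (invP g)
  AgreeOn-invP {m} {g} m⁻¹-closed agree x s =
    sym (trans (cong (from g) (sym (trans (sym (agree (from m x) (m⁻¹-closed s))) (to-from m x)))) (from-to g (from m x)))

module _ {A : Set} (S : A → Set) where

  prodP-fixes : ∀ {m} (t : Fin m → Perm A) → (∀ i x → S x → to (t i) x ≡ x) → ∀ x → S x → to (prodP t) x ≡ x
  prodP-fixes {zero}  t fixes x s = refl
  prodP-fixes {suc m} t fixes x s =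
    trans (cong (to (t fzero)) (prodP-fixes (λ i → t (fsuc i)) (λ i → fixes (fsuc i)) x s)) (fixes fzero x s)

  prodP-acts-as-factor : ∀ {m} (t : Fin m → Perm A) (j : Fin m) →
    (∀ i → i ≢ j → ∀ x → S x → to (t i) x ≡ x) → (∀ x → S x → S (to (t j) x)) →
    ∀ x → S x → to (prodP t) x ≡ to (t j) x
  prodP-acts-as-factor {suc m} t fzero     others-fix t-pres x s =
    cong (to (t fzero)) (prodP-fixes (λ i → t (fsuc i)) (λ i → others-fix (fsuc i) λ ()) x s)
  prodP-acts-as-factor {suc m} t (fsuc j) others-fix t-pres x s =
    trans (cong (to (t fzero)) (prodP-acts-as-factor (λ i → t (fsuc i)) j
                                  (λ i i≢j → others-fix (fsuc i) λ e → i≢j (Fin.suc-injective e)) t-pres x s))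
          (others-fix fzero (λ ()) _ (t-pres x s))

module _ {A B C : Set} {ℓ₁ ℓ₂ ℓ₃ : Level} {H : PSet A ℓ₁} {K : PSet B ℓ₂} {L : PSet C ℓ₃} where

  Iso-trans : (∀ {g h} → g ≈P h → K g → K h) → Iso H K → Iso K L → Iso H L
  Iso-trans K-resp H≅K K≅L = record
    { φ      = φ
    ; φ-mem  = λ g p → I₂.φ-mem (I₁.φ g p) (I₁.φ-mem g p)
    ; φ-resp = λ g g' p p' e → I₂.φ-resp _ _ _ _ (I₁.φ-resp g g' p p' e)
    ; φ-hom  = hom
    ; φ-inj  = λ g h p q e → I₁.φ-inj g h p q (I₂.φ-inj _ _ _ _ e)
    ; φ-surj = surj
    }
    where
      module I₁ = Iso H≅K
      module I₂ = Iso K≅L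

      φ : (g : Perm A) → H g → Perm C
      φ g p = I₂.φ (I₁.φ g p) (I₁.φ-mem g p)

      hom : ∀ g h p q r → φ (g ∘P h) r ≈P (φ g p ∘P φ h q)
      hom g h p q r x =
        trans (I₂.φ-resp _ _ (I₁.φ-mem (g ∘P h) r) gh∈K (I₁.φ-hom g h p q r) x)
              (I₂.φ-hom (I₁.φ g p) (I₁.φ h q) (I₁.φ-mem g p) (I₁.φ-mem h q) gh∈K x)
        where gh∈K = K-resp (I₁.φ-hom g h p q r) (I₁.φ-mem (g ∘P h) r)

      surj : ∀ l → L l → Σ[ g ∈ Perm A ] Σ[ p ∈ H g ] (φ g p ≈P l)
      surj l l∈L with I₂.φ-surj l l∈L
      ... | k , k∈K , φk≈l with I₁.φ-surj k k∈K
      ...   | g , g∈H , φg≈k = g , g∈H , λ x → trans (I₂.φ-resp _ _ _ _ φg≈k x) (φk≈l x)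

module _ {A B : Set} {ℓ₁ ℓ₂ : Level} {H : PSet A ℓ₁} {K : PSet B ℓ₂} where

  Iso-sym : IsSubgroup H → Iso H K → Iso K H
  Iso-sym H≤ H≅K = record
    { φ      = ψ
    ; φ-mem  = ψ-mem
    ; φ-resp = λ k k' q q' e → I.φ-inj _ _ _ _ λ x → trans (φψ k q x) (trans (e x) (sym (φψ k' q' x)))
    ; φ-hom  = hom
    ; φ-inj  = λ k k' q q' e x → trans (sym (φψ k q x)) (trans (I.φ-resp _ _ _ _ e x) (φψ k' q' x))
    ; φ-surj = λ g p → I.φ g p , I.φ-mem g p , I.φ-inj _ _ _ _ (φψ (I.φ g p) (I.φ-mem g p))
    }
    where
      module I = Iso H≅K

      ψ : (k : Perm B) → K k → Perm A
      ψ k q = proj₁ (I.φ-surj k q)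

      ψ-mem : ∀ k q → H (ψ k q)
      ψ-mem k q = proj₁ (proj₂ (I.φ-surj k q))

      φψ : ∀ k q → I.φ (ψ k q) (ψ-mem k q) ≈P k
      φψ k q = proj₂ (proj₂ (I.φ-surj k q))

      hom : ∀ k k' q q' r → ψ (k ∘P k') r ≈P (ψ k q ∘P ψ k' q')
      hom k k' q q' r = I.φ-inj _ _ _ ψψ∈H λ x →
        trans (φψ (k ∘P k') r x)
              (sym (trans (I.φ-hom (ψ k q) (ψ k' q') (ψ-mem k q) (ψ-mem k' q') ψψ∈H x)
                          (trans (cong (to (I.φ (ψ k q) (ψ-mem k q))) (φψ k' q' x)) (φψ k q (to k' x)))))
        where ψψ∈H = IsSubgroup.closed-∘ H≤ (ψ-mem k q) (ψ-mem k' q')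

NormalClosure : {A : Set} → PSet A ℓ → Perm A → PSet A ℓ
NormalClosure {A = A} H g = Gen λ x → Σ[ k ∈ Perm A ] (H k × x ≈P conj k g)

module _ {A : Set} {H : PSet A ℓ} (H≤ : IsSubgroup H) where

  NormalClosure-normal : ∀ {g} → H g → IsNormal (NormalClosure H g) H
  NormalClosure-normal {g} g∈H =
      Gen-isSubgroup
    , Gen-least H≤ (λ x (k , k∈H , x≈kgk⁻¹) → IsSubgroup.resp H≤ (λ y → sym (x≈kgk⁻¹ y)) (conj-closed H≤ k∈H g∈H))
    , λ k h k∈H → Gen-conj-closed k λ (k' , k'∈H , e) → k ∘P k' , IsSubgroup.closed-∘ H≤ k∈H k'∈H
          , λ y → cong (to k) (e (from k y))

  NormalClosure-∋ : ∀ g → NormalClosure H g g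
  NormalClosure-∋ g = gen (idP , IsSubgroup.has-id H≤ , λ _ → refl)

  NormalClosure-least : {K : PSet A ℓ'} → IsNormal K H → ∀ {g} → K g → NormalClosure H g ⊆ K
  NormalClosure-least K⊴H g∈K = Gen-least (normal⇒subgroup K⊴H)
    λ x (k , k∈H , x≈kgk⁻¹) → IsSubgroup.resp (normal⇒subgroup K⊴H) (λ y → sym (x≈kgk⁻¹ y)) (normal-conj K⊴H k∈H g∈K)

module _ {B : Set} where

  count : {P : B → Set} → ((x : B) → Dec (P x)) → List B → ℕ
  count P? []       = zero
  count P? (x ∷ xs) with P? x
  ... | yes _ = suc (count P? xs)
  ... | no _  = count P? xs

  module _ {P Q : B → Set} (P? : (x : B) → Dec (P x)) (Q? : (x : B) → Dec (Q x)) (P⇒Q : ∀ x → P x → Q x) where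

    count-mono : ∀ xs → count P? xs ≤ count Q? xs
    count-mono []       = z≤n
    count-mono (x ∷ xs) with P? x | Q? x
    ... | yes _ | yes _ = s≤s (count-mono xs)
    ... | yes p | no ¬q = ⊥-elim (¬q (P⇒Q x p))
    ... | no _  | yes _ = ℕ.m≤n⇒m≤1+n (count-mono xs)
    ... | no _  | no _  = count-mono xs

    count-mono-< : ∀ xs {y} → y ∈ xs → Q y → ¬ P y → count P? xs < count Q? xs
    count-mono-< (x ∷ xs) (here refl) qy ¬py with P? x | Q? x
    ... | yes p | _     = ⊥-elim (¬py p)
    ... | no _  | yes _ = s≤s (count-mono xs)
    ... | no _  | no ¬q = ⊥-elim (¬q qy)
    count-mono-< (x ∷ xs) (there y∈xs) qy ¬py with P? x | Q? x
    ... | yes _ | yes _ = s≤s (count-mono-< xs y∈xs qy ¬py)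
    ... | yes p | no ¬q = ⊥-elim (¬q (P⇒Q x p))
    ... | no _  | yes _ = ℕ.m≤n⇒m≤1+n (count-mono-< xs y∈xs qy ¬py)
    ... | no _  | no _  = count-mono-< xs y∈xs qy ¬py

module Finite {A : Set} (enum : List A) (enum-complete : ∀ x → x ∈ enum) (_≟_ : DecidableEquality A) where

  ∀? : {P : A → Set} → ((x : A) → Dec (P x)) → Dec (∀ x → P x)
  ∀? P? = map′ (λ all x → All.lookup all (enum-complete x)) (λ p → All.tabulate λ {x} _ → p x) (all? P? enum)

  _≈P?_ : (g h : Perm A) → Dec (g ≈P h)
  g ≈P? h = ∀? λ x → to g x ≟ to h x

  Gen-≉id⇒generator : {S : PSet A ℓ} → ∀ {g} → Gen S g → ¬ g ≈P idP → Σ[ h ∈ Perm A ] (S h × ¬ h ≈P idP)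
  Gen-≉id⇒generator (gen s) g≉id = _ , s , g≉id
  Gen-≉id⇒generator gid g≉id = ⊥-elim (g≉id λ _ → refl)
  Gen-≉id⇒generator (gmul {g} {h} p q) gh≉id with g ≈P? idP
  ... | no g≉id = Gen-≉id⇒generator p g≉id
  ... | yes g≈id = Gen-≉id⇒generator q λ h≈id → gh≉id λ x → trans (g≈id (to h x)) (h≈id x)
  Gen-≉id⇒generator (ginv {g} p) g⁻¹≉id = Gen-≉id⇒generator p λ g≈id → g⁻¹≉id λ x → from-fixed g (g≈id x)
  Gen-≉id⇒generator (gres e p) h≉id = Gen-≉id⇒generator p λ g≈id → h≉id λ x → trans (sym (e x)) (g≈id x)

  lists : ℕ → List (List A)
  lists zero    = [] ∷ []
  lists (suc m) = concatMap (λ a → map (a ∷_) (lists m)) enum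

  lists-complete : (l : List A) → l ∈ lists (length l)
  lists-complete []      = here refl
  lists-complete (a ∷ l) = ∈-concatMap⁺ (λ b → map (b ∷_) (lists (length l)))
    (Any.map (λ { refl → ∈-map⁺ (a ∷_) (lists-complete l) }) (enum-complete a))

  code : Perm A → List A
  code g = map (to g) enum

  codes : List (List A)
  codes = lists (length enum)

  code∈codes : (g : Perm A) → code g ∈ codes
  code∈codes g = subst (λ m → code g ∈ lists m) (length-map (to g) enum) (lists-complete (code g))

  map-≡⇒≗ : {C : Set} (f f' : A → C) (l : List A) → map f l ≡ map f' l → ∀ {x} → x ∈ l → f x ≡ f' x
  map-≡⇒≗ f f' (y ∷ l) e (here refl) = proj₁ (∷-injective e)
  map-≡⇒≗ f f' (y ∷ l) e (there x∈l) = map-≡⇒≗ f f' l (proj₂ (∷-injective e)) x∈l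

  code-injective : (g h : Perm A) → code g ≡ code h → g ≈P h
  code-injective g h e x = map-≡⇒≗ (to g) (to h) enum e (enum-complete x)

  module _ (em : ExcludedMiddle lzero) where

    trivial⊎nonTrivial : (K : PSet A lzero) → Trivial K ⊎ NonTrivial K
    trivial⊎nonTrivial K with em {Σ[ g ∈ Perm A ] (K g × ¬ g ≈P idP)}
    ... | yes nontrivial = inj₂ nontrivial
    ... | no ¬nontrivial = inj₁ λ g g∈K → decidable-stable (g ≈P? idP) λ g≉id → ¬nontrivial (g , g∈K , g≉id)

    -- |K|, counted through the codes of its elements.
    size : PSet A lzero → ℕ
    size K = count (λ l → em {Σ[ g ∈ Perm A ] (K g × code g ≡ l)}) codes

    size-mono-< : {K K' : PSet A lzero} → IsSubgroup K → K ⊆ K' → ∀ {g} → K' g → ¬ K g → size K < size K'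
    size-mono-< K≤ K⊆K' {g} g∈K' g∉K =
      count-mono-< _ _ (λ l (h , h∈K , e) → h , K⊆K' h h∈K , e) codes (code∈codes g) (g , g∈K' , refl)
        λ (h , h∈K , e) → g∉K (IsSubgroup.resp K≤ (code-injective h g e) h∈K)

    module _ {H : PSet A lzero} (H≤ : IsSubgroup H) where

      -- A non-minimal K contains the strictly smaller normal closure of one of its elements.
      minimalNormal⊆-fuel : (fuel : ℕ) (K : PSet A lzero) → size K < fuel → IsNormal K H → NonTrivial K →
        Σ[ M ∈ PSet A lzero ] (MinimalNormal M H × M ⊆ K)
      minimalNormal⊆-fuel (suc fuel) K size<fuel K⊴H K≠1
        with em {Σ[ g ∈ Perm A ] (K g × ¬ g ≈P idP × Σ[ k ∈ Perm A ] (K k × ¬ NormalClosure H g k))}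
      ... | yes (g , g∈K , g≉id , k , k∈K , k∉⟨g⟩) =
        let M , M-min , M⊆⟨g⟩ = minimalNormal⊆-fuel fuel (NormalClosure H g)
              (ℕ.<-≤-trans (size-mono-< Gen-isSubgroup (NormalClosure-least H≤ K⊴H g∈K) k∈K k∉⟨g⟩)
                  (ℕ.≤-pred size<fuel))
              (NormalClosure-normal H≤ (normal⇒⊆ K⊴H g g∈K)) (g , NormalClosure-∋ H≤ g , g≉id)
        in M , M-min , λ x x∈M → NormalClosure-least H≤ K⊴H g∈K x (M⊆⟨g⟩ x x∈M)
      ... | no ¬proper = K , (K⊴H , K≠1 , minimal) , λ _ x∈K → x∈K
        where
          minimal : ∀ (K' : PSet A lzero) → IsNormal K' H → K' ⊆ K → Trivial K' ⊎ (K ⊆ K')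
          minimal K' K'⊴H K'⊆K with trivial⊎nonTrivial K'
          ... | inj₁ K'≈1 = inj₁ K'≈1
          ... | inj₂ (g , g∈K' , g≉id) = inj₂ λ x x∈K → NormalClosure-least H≤ K'⊴H g∈K' x (x∈⟨g⟩ x x∈K)
            where
              x∈⟨g⟩ : ∀ x → K x → NormalClosure H g x
              x∈⟨g⟩ x x∈K = decidable-stable em λ x∉⟨g⟩ → ¬proper (g , K'⊆K g g∈K' , g≉id , x , x∈K , x∉⟨g⟩)

      minimalNormal⊆ : (K : PSet A lzero) → IsNormal K H → NonTrivial K →
          Σ[ M ∈ PSet A lzero ] (MinimalNormal M H × M ⊆ K)
      minimalNormal⊆ K = minimalNormal⊆-fuel (suc (size K)) K ℕ.≤-refl

module Representatives {A : Set} (R : A → A → Set) (R? : ∀ x y → Dec (R x y))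
    (R-refl : ∀ x → R x x) (R-sym : ∀ {x y} → R x y → R y x) where

  private
    Unrelated : A → A → Set
    Unrelated x y = ¬ R x y

    extend : List A → List A → List A
    extend acc []       = acc
    extend acc (x ∷ xs) with any? (λ y → R? y x) acc
    ... | yes _ = extend acc xs
    ... | no _  = extend (x ∷ acc) xs

    extend-pairwise : ∀ acc xs → AllPairs Unrelated acc → AllPairs Unrelated (extend acc xs)
    extend-pairwise acc []       acc-pw = acc-pw
    extend-pairwise acc (x ∷ xs) acc-pw with any? (λ y → R? y x) acc
    ... | yes _ = extend-pairwise acc xs acc-pw
    ... | no x∉acc = extend-pairwise (x ∷ acc) xs (unrelated acc x∉acc ∷ acc-pw)
      where
        unrelated : ∀ l → ¬ Any (λ y → R y x) l → All (Unrelated x) l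
        unrelated []      _     = []
        unrelated (y ∷ l) x∉yl = (λ r → x∉yl (here (R-sym r))) ∷ unrelated l (λ a → x∉yl (there a))

    extend-keeps : ∀ z acc xs → Any (λ y → R y z) acc → Any (λ y → R y z) (extend acc xs)
    extend-keeps z acc []       a = a
    extend-keeps z acc (x ∷ xs) a with any? (λ y → R? y x) acc
    ... | yes _ = extend-keeps z acc xs a
    ... | no _  = extend-keeps z (x ∷ acc) xs (there a)

    extend-covers : ∀ z acc xs → z ∈ xs → Any (λ y → R y z) (extend acc xs)
    extend-covers z acc (x ∷ xs) (here refl) with any? (λ y → R? y x) acc
    ... | yes a = extend-keeps z acc xs a
    ... | no _  = extend-keeps z (x ∷ acc) xs (here (R-refl z))
    extend-covers z acc (x ∷ xs) (there z∈xs) with any? (λ y → R? y x) acc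
    ... | yes _ = extend-covers z acc xs z∈xs
    ... | no _  = extend-covers z (x ∷ acc) xs z∈xs

    All-lookup : ∀ {P : A → Set} {l : List A} → All P l → (i : Fin (length l)) → P (lookup l i)
    All-lookup (p ∷ ps) fzero    = p
    All-lookup (p ∷ ps) (fsuc i) = All-lookup ps i

    AllPairs-lookup : ∀ {l : List A} → AllPairs Unrelated l → (i j : Fin (length l)) → i ≢ j →
      Unrelated (lookup l i) (lookup l j)
    AllPairs-lookup (a ∷ ap) fzero    fzero    i≢j = ⊥-elim (i≢j refl)
    AllPairs-lookup (a ∷ ap) fzero    (fsuc j) i≢j = All-lookup a j
    AllPairs-lookup (a ∷ ap) (fsuc i) fzero    i≢j = λ r → All-lookup a i (R-sym r)
    AllPairs-lookup (a ∷ ap) (fsuc i) (fsuc j) i≢j = AllPairs-lookup ap i j λ e → i≢j (cong fsuc e)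

  module _ (xs : List A) where

    reps : List A
    reps = extend [] xs

    #reps : ℕ
    #reps = length reps

    rep : Fin #reps → A
    rep = lookup reps

    rep-unique : ∀ i j → R (rep i) (rep j) → i ≡ j
    rep-unique i j r with i Fin.≟ j
    ... | yes i≡j = i≡j
    ... | no i≢j  = ⊥-elim (AllPairs-lookup (extend-pairwise [] xs []) i j i≢j r)

    rep-covers : ∀ {x} → x ∈ xs → Σ[ i ∈ Fin #reps ] R (rep i) x
    rep-covers x∈xs = Any.index covering , lookup-index covering
      where covering = extend-covers _ [] xs x∈xs

module Blocks {n : ℕ} (β : Fin n → Fin n) where

  Blk-≡ : ∀ {b} {u v : Blk β b} → proj₁ u ≡ proj₁ v → u ≡ v
  Blk-≡ {u = y , p} {.y , q} refl = cong (y ,_) (Decidable⇒UIP.≡-irrelevant Fin._≟_ p q)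

  _≟Blk_ : ∀ {b} → DecidableEquality (Blk β b)
  u ≟Blk v = map′ Blk-≡ (cong proj₁) (proj₁ u Fin.≟ proj₁ v)

  blkList : (b : Fin n) → List (Fin n) → List (Blk β b)
  blkList b []       = []
  blkList b (y ∷ ys) with β y Fin.≟ β b
  ... | yes p = (y , p) ∷ blkList b ys
  ... | no _  = blkList b ys

  blkList-complete : ∀ b ys (u : Blk β b) → proj₁ u ∈ ys → u ∈ blkList b ys
  blkList-complete b (y ∷ ys) u (here e) with β y Fin.≟ β b
  ... | yes p = here (Blk-≡ e)
  ... | no ¬p = ⊥-elim (¬p (subst (λ z → β z ≡ β b) e (proj₂ u)))
  blkList-complete b (y ∷ ys) u (there u∈ys) with β y Fin.≟ β b
  ... | yes _ = there (blkList-complete b ys u u∈ys)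
  ... | no _  = blkList-complete b ys u u∈ys

  module FiniteBlk (b : Fin n) =
    Finite (blkList b (allFin n)) (λ u → blkList-complete b (allFin n) u (∈-allFin (proj₁ u))) _≟Blk_

  FixesBlock : Perm (Fin n) → Fin n → Set
  FixesBlock g b = ∀ y → β y ≡ β b → to g y ≡ y

  restrict : (g : Perm (Fin n)) → (∀ x → β (to g x) ≡ β x) → (b : Fin n) → Perm (Blk β b)
  restrict g g-stable b = mkPerm
    (λ (y , p) → to g y , trans (g-stable y) p)
    (λ (y , p) → from g y , trans (sym (g-stable (from g y))) (trans (cong β (to-from g y)) p))
    (λ (y , _) → Blk-≡ (from-to g y))
    (λ (y , _) → Blk-≡ (to-from g y))

  module _ {b : Fin n} where

    Restricts-unique : ∀ {g} {σ τ : Perm (Blk β b)} → Restricts β b g σ → Restricts β b g τ → σ ≈P τ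
    Restricts-unique r s u = Blk-≡ (trans (r u) (sym (s u)))

    Restricts-respʳ : ∀ {g} (σ τ : Perm (Blk β b)) → σ ≈P τ → Restricts β b g σ → Restricts β b g τ
    Restricts-respʳ σ τ e r u = trans (cong proj₁ (sym (e u))) (r u)

    Restricts-respˡ : ∀ {g h} {σ : Perm (Blk β b)} → g ≈P h → Restricts β b g σ → Restricts β b h σ
    Restricts-respˡ e r u = trans (r u) (e (proj₁ u))

    Restricts-id : Restricts β b idP idP
    Restricts-id u = refl

    Restricts-∘ : ∀ {g h} (σ τ : Perm (Blk β b)) → Restricts β b g σ → Restricts β b h τ →
      Restricts β b (g ∘P h) (σ ∘P τ)
    Restricts-∘ {g} σ τ r s u = trans (r (to τ u)) (cong (to g) (s u))

    Restricts-inv : ∀ {g} (σ : Perm (Blk β b)) → Restricts β b g σ → Restricts β b (invP g) (invP σ)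
    Restricts-inv {g} σ r u =
      trans (sym (from-to g (proj₁ (from σ u)))) (cong (from g) (trans (sym (r (from σ u))) (cong proj₁ (to-from σ u))))

    Restricts-conj : ∀ {g h} (σ τ : Perm (Blk β b)) → Restricts β b g σ → Restricts β b h τ →
      Restricts β b (conj g h) (conj σ τ)
    Restricts-conj {g} {h} σ τ r s = Restricts-∘ {g ∘P h} {invP g} (σ ∘P τ) (invP σ)
        (Restricts-∘ {g} {h} σ τ r s) (Restricts-inv {g} σ r)

    Restricts-comm : ∀ {g h} (σ τ : Perm (Blk β b)) → Restricts β b g σ → Restricts β b h τ →
      Restricts β b (comm g h) (comm σ τ)
    Restricts-comm {g} {h} σ τ r s =
      Restricts-∘ {conj g h} {invP h} (conj σ τ) (invP τ) (Restricts-conj {g} {h} σ τ r s) (Restricts-inv {h} τ s)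

    FixesBlock⇒Restricts-id : ∀ {g} {σ : Perm (Blk β b)} → Restricts β b g σ → FixesBlock g b → σ ≈P idP
    FixesBlock⇒Restricts-id r fixes u = Blk-≡ (trans (r u) (fixes (proj₁ u) (proj₂ u)))

    Restricts-id⇒FixesBlock : ∀ {g} {σ : Perm (Blk β b)} → Restricts β b g σ → σ ≈P idP → FixesBlock g b
    Restricts-id⇒FixesBlock r σ≈id y p = trans (sym (r (y , p))) (cong proj₁ (σ≈id (y , p)))

  supp-Induced⁻ : {K : PSet (Fin n) ℓ} {b : Fin n} {u : Blk β b} → supp (Induced K β b) u → supp K (proj₁ u)
  supp-Induced⁻ (σ , (m , m∈K , r) , σu≢u) = m , m∈K , λ mu≡u → σu≢u (Blk-≡ (trans (r _) mu≡u))

  module _ {H : PSet (Fin n) ℓ} (H≤ : IsSubgroup H) (b : Fin n) where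
    open IsSubgroup H≤

    Induced-isSubgroup : IsSubgroup (Induced H β b)
    Induced-isSubgroup = record
      { resp       = λ {σ} {τ} e (g , g∈H , r) → g , g∈H , Restricts-respʳ {g = g} σ τ e r
      ; has-id     = idP , has-id , Restricts-id
      ; closed-∘   = λ {σ} {τ} (g , g∈H , r) (h , h∈H , s) → g ∘P h , closed-∘ g∈H h∈H , Restricts-∘ {g = g} {h} σ τ r s
      ; closed-inv = λ {σ} (g , g∈H , r) → invP g , closed-inv g∈H , Restricts-inv {g = g} σ r
      }

  Induced-normal : {M : PSet (Fin n) ℓ} {H : PSet (Fin n) ℓ'} → IsNormal M H → (b : Fin n) →
    IsNormal (Induced M β b) (Induced H β b)
  Induced-normal M⊴H b =
      Induced-isSubgroup (normal⇒subgroup M⊴H) b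
    , (λ σ (m , m∈M , r) → m , normal⇒⊆ M⊴H m m∈M , r)
    , λ κ σ (g , g∈H , r) (m , m∈M , s) → conj g m , normal-conj M⊴H g∈H m∈M , Restricts-conj {g = g} {m} κ σ r s

  module _ {G : PSet (Fin n) ℓ} where

    Fix-isSubgroup : IsSubgroup G → IsSubgroup (Fix G β)
    Fix-isSubgroup G≤ = record
      { resp       = λ {g} e (g∈G , g-stable) → resp e g∈G , λ x → trans (cong β (sym (e x))) (g-stable x)
      ; has-id     = has-id , λ _ → refl
      ; closed-∘   = λ {g} {h} (g∈G , g-stable) (h∈G , h-stable) → closed-∘ g∈G h∈G ,
          λ x → trans (g-stable (to h x)) (h-stable x)
      ; closed-inv = λ {g} (g∈G , g-stable) → closed-inv g∈G ,
          λ x → trans (sym (g-stable (from g x))) (cong β (to-from g x))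
      }
      where open IsSubgroup G≤

    Fix-conj : IsSubgroup G → IsBlockSystem G β → ∀ {h m} → G h → Fix G β m → Fix G β (conj h m)
    Fix-conj G≤ G-blocks {h} {m} h∈G (m∈G , m-stable) =
        conj-closed G≤ h∈G m∈G
      , λ x → trans (G-blocks h h∈G _ _ (m-stable (from h x))) (cong β (to-from h x))

module _ {A : Set} {T : PSet A ℓ} {M : PSet A lzero} where

  -- Simplicity quantifies over all predicates, so applying it to {1} ∪ (Q ∧ M) decides Q.
  simple⇒excludedMiddle : Simple T → IsNormal M T → NonTrivial M → ExcludedMiddle lzero
  simple⇒excludedMiddle (T≤ , _ , T-simple) M⊴T (h , h∈M , h≉id) {Q}
    with T-simple K (K-isSubgroup , K⊆T , K-conj)
    where
      open IsSubgroup (normal⇒subgroup M⊴T)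

      K : PSet A lzero
      K σ = σ ≈P idP ⊎ (Q × M σ)

      K-isSubgroup : IsSubgroup K
      K-isSubgroup = record
        { resp       = λ { e (inj₁ σ≈id) → inj₁ λ u → trans (sym (e u)) (σ≈id u)
                         ; e (inj₂ (q , σ∈M)) → inj₂ (q , resp e σ∈M) }
        ; has-id     = inj₁ λ _ → refl
        ; closed-∘   = λ { {σ} {τ} (inj₁ σ≈id) (inj₁ τ≈id) → inj₁ λ u → trans (σ≈id (to τ u)) (τ≈id u)
                         ; {σ} {τ} (inj₁ σ≈id) (inj₂ (q , τ∈M)) → inj₂ (q , resp (λ u → sym (σ≈id (to τ u))) τ∈M)
                         ; {σ} {τ} (inj₂ (q , σ∈M)) (inj₁ τ≈id) → inj₂ (q , resp (λ u → cong (to σ) (sym (τ≈id u))) σ∈M)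
                         ; (inj₂ (q , σ∈M)) (inj₂ (_ , τ∈M)) → inj₂ (q , closed-∘ σ∈M τ∈M) }
        ; closed-inv = λ { {σ} (inj₁ σ≈id) → inj₁ λ u → from-fixed σ (σ≈id u)
                         ; (inj₂ (q , σ∈M)) → inj₂ (q , closed-inv σ∈M) }
        }

      K⊆T : K ⊆ T
      K⊆T σ (inj₁ σ≈id) = IsSubgroup.resp T≤ (λ u → sym (σ≈id u)) (IsSubgroup.has-id T≤)
      K⊆T σ (inj₂ (_ , σ∈M)) = normal⇒⊆ M⊴T σ σ∈M

      K-conj : ∀ t σ → T t → K σ → K (conj t σ)
      K-conj t σ t∈T (inj₁ σ≈id) = inj₁ λ u → trans (cong (to t) (σ≈id (from t u))) (to-from t u)
      K-conj t σ t∈T (inj₂ (q , σ∈M)) = inj₂ (q , normal-conj M⊴T t∈T σ∈M)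
  ... | inj₁ K≈1 = no λ q → h≉id (K≈1 h (inj₂ (q , h∈M)))
  ... | inj₂ T⊆K with T⊆K h (normal⇒⊆ M⊴T h h∈M)
  ...   | inj₁ h≈id   = ⊥-elim (h≉id h≈id)
  ...   | inj₂ (q , _) = yes q

minimalNormal⊴Soc : {A : Set} {H : PSet A ℓ} {M : PSet A lzero} → IsSubgroup H → MinimalNormal M H → IsNormal M (Soc H)
minimalNormal⊴Soc H≤ M-min@(M⊴H , _) =
  normal⇒subgroup M⊴H , (λ σ σ∈M → gen (_ , M-min , σ∈M))
    , λ t σ t∈Soc σ∈M → normal-conj M⊴H (Soc⊆ H≤ t t∈Soc) σ∈M

≉idP⇒moves : {A : Set} → ExcludedMiddle lzero → DecidableEquality A → (g : Perm A) → ¬ g ≈P idP →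
  Σ[ y ∈ A ] ¬ to g y ≡ y
≉idP⇒moves em _≟_ g g≉id =
  decidable-stable em λ fixes-all → g≉id λ y → decidable-stable (to g y ≟ y) λ gy≢y → fixes-all (y , gy≢y)

module _ {A : Set} where

  Centralises : Perm A → PSet A ℓ → Set ℓ
  Centralises g M = ∀ m → M m → (g ∘P m) ≈P (m ∘P g)

  Centraliser : PSet A ℓ → PSet A ℓ' → PSet A (ℓ ⊔ ℓ')
  Centraliser H K σ = H σ × Centralises σ K

  Centraliser-normal : {H : PSet A ℓ} {K : PSet A ℓ'} → IsSubgroup H → IsNormal K H → IsNormal (Centraliser H K) H
  Centraliser-normal {H = H} {K} H≤ K⊴H = C-isSubgroup , (λ σ → proj₁) , C-conj
    where
      open IsSubgroup H≤

      C-isSubgroup : IsSubgroup (Centraliser H K)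
      C-isSubgroup = record
        { resp       = λ {σ} {σ'} e (σ∈H , c) → resp e σ∈H , λ τ τ∈K u →
                         trans (sym (e (to τ u))) (trans (c τ τ∈K u) (cong (to τ) (e u)))
        ; has-id     = has-id , λ τ τ∈K u → refl
        ; closed-∘   = λ {σ} {σ'} (σ∈H , c) (σ'∈H , c') → closed-∘ σ∈H σ'∈H , λ τ τ∈K u →
                         trans (cong (to σ) (c' τ τ∈K u)) (c τ τ∈K (to σ' u))
        ; closed-inv = λ {σ} (σ∈H , c) → closed-inv σ∈H , λ τ τ∈K u →
                         trans (cong (λ z → from σ (to τ z)) (sym (to-from σ u)))
                               (trans (cong (from σ) (sym (c τ τ∈K (from σ u)))) (from-to σ (to τ (from σ u))))
        }

      -- κσκ⁻¹ commutes with τ because σ commutes with κ⁻¹τκ ∈ K.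
      C-conj : ∀ κ σ → H κ → Centraliser H K σ → Centraliser H K (conj κ σ)
      C-conj κ σ κ∈H (σ∈H , c) = conj-closed H≤ κ∈H σ∈H , λ τ τ∈K v →
        let σ-τ' = c (conj (invP κ) τ) (normal-conj K⊴H (closed-inv κ∈H) τ∈K) in
        trans (sym (to-from κ _))
          (trans (cong (to κ)
                   (sym (trans (sym (σ-τ' (from κ v)))
                     (trans (cong (λ z → to σ (from κ (to τ z))) (to-from κ v))
                            (sym (from-to κ (to σ (from κ (to τ v)))))))))
                 (to-from κ (to τ (to κ (to σ (from κ v))))))

  Conjugate : Perm A → PSet A ℓ → PSet A ℓ
  Conjugate h M g = Σ[ m ∈ Perm A ] (M m × g ≈P conj h m)

  supp-Conjugate⁺ : {M : PSet A ℓ} (h : Perm A) → ∀ {x} → supp M x → supp (Conjugate h M) (to h x)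
  supp-Conjugate⁺ h {x} (m , m∈M , mx≢x) = conj h m , (m , m∈M , λ _ → refl) ,
    λ e → mx≢x (to-injective h (trans (cong (λ z → to h (to m z)) (sym (from-to h x))) e))

  supp-Conjugate⁻ : {M : PSet A ℓ} (h : Perm A) → ∀ {x} → supp (Conjugate h M) (to h x) → supp M x
  supp-Conjugate⁻ h {x} (c , (m , m∈M , c≈hmh⁻¹) , cx≢x) = m , m∈M ,
    λ mx≡x → cx≢x (trans (c≈hmh⁻¹ (to h x)) (trans (cong (λ z → to h (to m z)) (from-to h x)) (cong (to h) mx≡x)))

  Centralises-conj : (k : Perm A) {g : Perm A} {M : PSet A ℓ} → Centralises g M → Centralises (conj k g) (Conjugate k M)
  Centralises-conj k {g} g-centralises m' (m , m∈M , m'≈) u =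
    trans (cong (λ z → to k (to g (from k z))) (m'≈ u))
      (trans (cong (λ z → to k (to g z)) (from-to k (to m (from k u))))
        (trans (cong (to k) (g-centralises m m∈M (from k u)))
          (trans (cong (λ z → to k (to m z)) (sym (from-to k (to g (from k u)))))
                 (sym (m'≈ (to k (to g (from k u))))))))

module _ {A : Set} {G : PSet A ℓ} {N : PSet A ℓ'} (G≤ : IsSubgroup G) (N⊴G : IsNormal N G) where

  Conjugate-normal : {M : PSet A lzero} → ∀ {h} → G h → IsNormal M N → IsNormal (Conjugate h M) N
  Conjugate-normal {M} {h} h∈G M⊴N = C-isSubgroup , C⊆N , C-conj
    where
      open IsSubgroup (normal⇒subgroup M⊴N)

      C-isSubgroup : IsSubgroup (Conjugate h M)
      C-isSubgroup = record
        { resp       = λ {g} {g'} e (m , m∈M , g≈) → m , m∈M , λ x → trans (sym (e x)) (g≈ x)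
        ; has-id     = idP , has-id , λ x → sym (to-from h x)
        ; closed-∘   = λ {g} {g'} (m , m∈M , g≈) (m' , m'∈M , g'≈) → m ∘P m' , closed-∘ m∈M m'∈M ,
                         λ x → trans (∘P-cong {g = g} {g' = conj h m} {h = g'} {h' = conj h m'} g≈ g'≈ x)
                             (sym (conj-∘P h m m' x))
        ; closed-inv = λ {g} (m , m∈M , g≈) → invP m , closed-inv m∈M , invP-cong {g = g} {g' = conj h m} g≈
        }

      C⊆N : Conjugate h M ⊆ N
      C⊆N g (m , m∈M , g≈) = IsSubgroup.resp (normal⇒subgroup N⊴G) (λ x → sym (g≈ x))
        (normal-conj N⊴G h∈G (normal⇒⊆ M⊴N m m∈M))

      -- k (h m h⁻¹) k⁻¹ = h ((h⁻¹ k h) m (h⁻¹ k h)⁻¹) h⁻¹ with h⁻¹ k h ∈ N.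
      C-conj : ∀ k g → N k → Conjugate h M g → Conjugate h M (conj k g)
      C-conj k g k∈N (m , m∈M , g≈) =
          conj (conj (invP h) k) m
        , normal-conj M⊴N (normal-conj N⊴G (IsSubgroup.closed-inv G≤ h∈G) k∈N) m∈M
        , λ x → trans (cong (to k) (g≈ (from k x)))
                  (sym (trans (to-from h _) (cong (λ z → to k (to h (to m (from h (from k z))))) (to-from h x))))

  Conjugate-minimalNormal : {M : PSet A lzero} → ∀ {h} → G h → MinimalNormal M N → MinimalNormal (Conjugate h M) N
  Conjugate-minimalNormal {M} {h} h∈G (M⊴N , (g , g∈M , g≉id) , M-minimal) =
    Conjugate-normal h∈G M⊴N , (conj h g , (g , g∈M , λ _ → refl) , λ e → g≉id (conj≈id⇒≈id h g e)) , minimal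
    where
      minimal : ∀ (K : PSet A lzero) → IsNormal K N → K ⊆ Conjugate h M → Trivial K ⊎ (Conjugate h M ⊆ K)
      minimal K K⊴N K⊆hMh⁻¹ with M-minimal (Conjugate (invP h) K)
          (Conjugate-normal (IsSubgroup.closed-inv G≤ h∈G) K⊴N) h⁻¹Kh⊆M
        where
          h⁻¹Kh⊆M : Conjugate (invP h) K ⊆ M
          h⁻¹Kh⊆M g (k , k∈K , g≈) with K⊆hMh⁻¹ k k∈K
          ... | m , m∈M , k≈ = IsSubgroup.resp (normal⇒subgroup M⊴N)
                 (λ x → sym (trans (g≈ x) (trans (cong (from h) (k≈ (to h x))) (invP-conj-cancel h m x)))) m∈M
      ... | inj₁ h⁻¹Kh≈1 = inj₁ λ k k∈K →
          conj≈id⇒≈id (invP h) k (h⁻¹Kh≈1 (conj (invP h) k) (k , k∈K , λ _ → refl))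
      ... | inj₂ M⊆h⁻¹Kh = inj₂ λ g (m , m∈M , g≈) → g∈K g m m∈M g≈
        where
          g∈K : ∀ g m → M m → g ≈P conj h m → K g
          g∈K g m m∈M g≈ with M⊆h⁻¹Kh m m∈M
          ... | k , k∈K , m≈ = IsSubgroup.resp (normal⇒subgroup K⊴N)
                 (λ x → sym (trans (g≈ x) (trans (cong (to h) (m≈ (from h x))) (conj-invP-cancel h k x)))) k∈K

semiregular-agree⇒≈ : {A : Set} {X : PSet A ℓ} → IsSubgroup X → Semiregular X →
  ∀ {u u'} → X u → X u' → ∀ x → to u x ≡ to u' x → u ≈P u'
semiregular-agree⇒≈ X≤ X-semiregular {u} {u'} u∈X u'∈X x ux≡u'x z =
  trans (sym (to-from u' (to u z))) (cong (to u') (u'⁻¹u≈id z))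
  where
    open IsSubgroup X≤
    u'⁻¹u≈id : (invP u' ∘P u) ≈P idP
    u'⁻¹u≈id = X-semiregular (invP u' ∘P u) x (closed-∘ (closed-inv u'∈X) u∈X)
        (trans (cong (from u') ux≡u'x) (from-to u' x))

module Setting (n : ℕ) (G : PSet (Fin n) lzero) (G≤ : IsSubgroup G) (G-transitive : Transitive G)
    (β : Fin n → Fin n) (β-normal : IsNormalBlockSystem G β) (b₀ : Fin n)
    (T-transitive : Transitive (Soc (Induced (Fix G β) β b₀)))
    (T-nonAbelian : NonAbelian (Soc (Induced (Fix G β) β b₀)))
    (T-simple : Simple (Soc (Induced (Fix G β) β b₀))) where

  open Blocks β
  private
    module FinN = Finite (allFin n) ∈-allFin Fin._≟_
    module FinB₀ = FiniteBlk b₀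

  N : PSet (Fin n) lzero
  N = Fix G β

  N≤ : IsSubgroup N
  N≤ = Fix-isSubgroup G≤

  N⊴G : IsNormal N G
  N⊴G = N≤ , (λ _ → proj₁) , λ _ _ → Fix-conj G≤ (proj₁ β-normal)

  N↾ : (b : Fin n) → PSet (Blk β b) lzero
  N↾ b = Induced N β b

  N↾≤ : ∀ b → IsSubgroup (N↾ b)
  N↾≤ = Induced-isSubgroup N≤

  T : PSet (Blk β b₀) (lsuc lzero)
  T = Soc (N↾ b₀)

  T⊆N↾b₀ : T ⊆ N↾ b₀
  T⊆N↾b₀ = Soc⊆ (N↾≤ b₀)

  private
    t₁ t₂ : Perm (Blk β b₀)
    t₁ = proj₁ T-nonAbelian
    t₂ = proj₁ (proj₂ T-nonAbelian)

    t₁∈T : T t₁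
    t₁∈T = proj₁ (proj₂ (proj₂ T-nonAbelian))

    t₂∈T : T t₂
    t₂∈T = proj₁ (proj₂ (proj₂ (proj₂ T-nonAbelian)))

    t₁t₂≉t₂t₁ : ¬ (t₁ ∘P t₂) ≈P (t₂ ∘P t₁)
    t₁t₂≉t₂t₁ = proj₂ (proj₂ (proj₂ (proj₂ T-nonAbelian)))

    t₁≉id : ¬ t₁ ≈P idP
    t₁≉id t₁≈id = t₁t₂≉t₂t₁ λ u → trans (t₁≈id (to t₂ u)) (cong (to t₂) (sym (t₁≈id u)))

  -- Simplicity only speaks about level-0 subgroups, so it is applied to a minimal normal subgroup of N↾b₀ inside T.
  abstract
    em : ExcludedMiddle lzero
    em = let h , (M , M-min , h∈M) , h≉id = FinB₀.Gen-≉id⇒generator t₁∈T t₁≉id in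
      simple⇒excludedMiddle T-simple (minimalNormal⊴Soc (N↾≤ b₀) M-min) (h , h∈M , h≉id)

  T⊆nontrivialNormal : (K : PSet (Blk β b₀) lzero) → IsNormal K (N↾ b₀) → NonTrivial K → T ⊆ K
  T⊆nontrivialNormal K K⊴ K≉1 with FinB₀.minimalNormal⊆ em (N↾≤ b₀) K K⊴ K≉1
  ... | M , M-min , M⊆K with proj₂ (proj₂ T-simple) M (minimalNormal⊴Soc (N↾≤ b₀) M-min)
  ...   | inj₁ M≈1 = let g , g∈M , g≉id = proj₁ (proj₂ M-min) in ⊥-elim (g≉id (M≈1 g g∈M))
  ...   | inj₂ T⊆M = λ σ σ∈T → M⊆K σ (T⊆M σ σ∈T)

  ActiveAt : PSet (Fin n) lzero → Fin n → Set
  ActiveAt M x = Σ[ m ∈ Perm (Fin n) ] (M m × Σ[ y ∈ Fin n ] (β y ≡ β x × ¬ to m y ≡ y))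

  supp⇒ActiveAt : ∀ {M x} → supp M x → ActiveAt M x
  supp⇒ActiveAt (m , m∈M , mx≢x) = m , m∈M , _ , refl , mx≢x

  T⊆restriction : (M : PSet (Fin n) lzero) → IsNormal M N → ActiveAt M b₀ → T ⊆ Induced M β b₀
  T⊆restriction M M⊴N (m , m∈M , y , p , my≢y) = T⊆nontrivialNormal (Induced M β b₀) (Induced-normal M⊴N b₀)
    (restrict m m-stable b₀ , (m , m∈M , λ _ → refl) , λ e → my≢y (cong proj₁ (e (y , p))))
    where m-stable = proj₂ (normal⇒⊆ M⊴N m m∈M)

  BlockKernel : Fin n → PSet (Fin n) lzero
  BlockKernel x = PtStab N (λ y → β y ≡ β x)

  BlockKernel-normal : ∀ x → IsNormal (BlockKernel x) N
  BlockKernel-normal x =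
      record
        { resp       = λ e (g∈N , fixes) → IsSubgroup.resp N≤ e g∈N , λ y p → trans (sym (e y)) (fixes y p)
        ; has-id     = IsSubgroup.has-id N≤ , λ _ _ → refl
        ; closed-∘   = λ {g} (g∈N , g-fixes) (h∈N , h-fixes) → IsSubgroup.closed-∘ N≤ g∈N h∈N ,
                         λ y p → trans (cong (to g) (h-fixes y p)) (g-fixes y p)
        ; closed-inv = λ {g} (g∈N , fixes) → IsSubgroup.closed-inv N≤ g∈N , λ y p → from-fixed g (fixes y p)
        }
    , (λ _ → proj₁)
    , λ k h k∈N (h∈N , h-fixes) → conj-closed N≤ k∈N h∈N ,
        λ y p → trans (cong (to k) (h-fixes (from k y) (trans (proj₂ (IsSubgroup.closed-inv N≤ k∈N) y) p))) (to-from k y)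

  fixesActiveBlock⇒≈id : ∀ {M} → MinimalNormal M N → ∀ {x} → ActiveAt M x →
    ∀ {m} → M m → FixesBlock m x → m ≈P idP
  fixesActiveBlock⇒≈id {M} (M⊴N , _ , M-minimal) {x} (m' , m'∈M , y , p , m'y≢y) {m} m∈M m-fixes
    with M-minimal (M ∩ BlockKernel x) (∩-normal M⊴N (BlockKernel-normal x)) (λ _ → proj₁)
  ... | inj₁ trivial = trivial m (m∈M , normal⇒⊆ M⊴N m m∈M , m-fixes)
  ... | inj₂ M⊆    = ⊥-elim (m'y≢y (proj₂ (proj₂ (M⊆ m' m'∈M)) y p))

  centralises⇒fixesActiveBlock₀ : ∀ {M} → MinimalNormal M N → ActiveAt M b₀ →
    ∀ {g} → N g → Centralises g M → FixesBlock g b₀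
  centralises⇒fixesActiveBlock₀ {M} (M⊴N , _) active {g} g∈N g-centralises =
    Restricts-id⇒FixesBlock {g = g} {g↾} (λ _ → refl) (C-trivial g↾ g↾∈C)
    where
      C : PSet (Blk β b₀) lzero
      C = Centraliser (N↾ b₀) (Induced M β b₀)

      -- Otherwise T ⊆ C, and T ⊆ M↾b₀ would make T abelian.
      C-trivial : Trivial C
      C-trivial with FinB₀.trivial⊎nonTrivial em C
      ... | inj₁ trivial = trivial
      ... | inj₂ nontrivial =
        ⊥-elim (t₁t₂≉t₂t₁ (t₁-centralises t₂ (T⊆restriction M M⊴N active t₂ t₂∈T)))
        where
          t₁-centralises : Centralises t₁ (Induced M β b₀)
          t₁-centralises = proj₂ (T⊆nontrivialNormal C (Centraliser-normal (N↾≤ b₀) (Induced-normal M⊴N b₀))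
                                    nontrivial t₁ t₁∈T)

      g↾ : Perm (Blk β b₀)
      g↾ = restrict g (proj₂ g∈N) b₀

      g↾∈C : C g↾
      g↾∈C = (g , g∈N , λ _ → refl) , λ τ (m , m∈M , r) →
        Restricts-unique {g = g ∘P m} {g↾ ∘P τ} {τ ∘P g↾}
          (Restricts-∘ {g = g} {m} g↾ τ (λ _ → refl) r)
          (Restricts-respˡ {g = m ∘P g} {g ∘P m} {τ ∘P g↾} (λ y → sym (g-centralises m m∈M y))
            (Restricts-∘ {g = m} {g} τ g↾ r (λ _ → refl)))

  carry : Fin n → Perm (Fin n)
  carry x = proj₁ (G-transitive b₀ x)

  carry∈G : ∀ x → G (carry x)
  carry∈G x = proj₁ (proj₂ (G-transitive b₀ x))

  carry⁻¹∈G : ∀ x → G (invP (carry x))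
  carry⁻¹∈G x = IsSubgroup.closed-inv G≤ (carry∈G x)

  carry-b₀ : ∀ x → to (carry x) b₀ ≡ x
  carry-b₀ x = proj₂ (proj₂ (G-transitive b₀ x))

  pull : ∀ x {y} → β y ≡ β x → β (from (carry x) y) ≡ β b₀
  pull x {y} p = trans (proj₁ β-normal _ (carry⁻¹∈G x) _ _ p)
                       (cong β (trans (cong (from (carry x)) (sym (carry-b₀ x))) (from-to (carry x) b₀)))

  push : ∀ x {y} → β y ≡ β b₀ → β (to (carry x) y) ≡ β x
  push x {y} p = trans (proj₁ β-normal _ (carry∈G x) _ _ p) (cong β (carry-b₀ x))

  Pulled : Fin n → PSet (Fin n) lzero → PSet (Fin n) lzero
  Pulled x = Conjugate (invP (carry x))

  Pulled-minimalNormal : ∀ x {M} → MinimalNormal M N → MinimalNormal (Pulled x M) N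
  Pulled-minimalNormal x = Conjugate-minimalNormal G≤ N⊴G (carry⁻¹∈G x)

  ActiveAt-pull : ∀ {M} x → ActiveAt M x → ActiveAt (Pulled x M) b₀
  ActiveAt-pull x (m , m∈M , y , p , my≢y) =
    let m' , m'∈ , m'y'≢y' = supp-Conjugate⁺ (invP (carry x)) (m , m∈M , my≢y) in
    m' , m'∈ , from (carry x) y , pull x p , m'y'≢y'

  centralises⇒fixesActiveBlock : ∀ {M} → MinimalNormal M N → ∀ {x} → ActiveAt M x →
    ∀ {g} → N g → Centralises g M → FixesBlock g x
  centralises⇒fixesActiveBlock {M} M-min {x} active {g} g∈N g-centralises y p =
    to-injective (invP h) (trans (cong (λ z → from h (to g z)) (sym (to-from h y))) (h⁻¹gh-fixes (from h y) (pull x p)))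
    where
      h = carry x
      h⁻¹gh-fixes : FixesBlock (conj (invP h) g) b₀
      h⁻¹gh-fixes = centralises⇒fixesActiveBlock₀ (Pulled-minimalNormal x M-min) (ActiveAt-pull x active)
        (normal-conj N⊴G (carry⁻¹∈G x) g∈N) (Centralises-conj (invP h) {g} {M} g-centralises)

  T-moves : ∀ u → supp T u
  T-moves u with ≉idP⇒moves em _≟Blk_ t₁ t₁≉id
  ... | u₁ , t₁u₁≢u₁ with T-transitive u u₁
  ...   | s , s∈T , su≡u₁ =
    conj (invP s) t₁ , conj-closed (proj₁ T-simple) (IsSubgroup.closed-inv (proj₁ T-simple) s∈T) t₁∈T ,
    λ e → t₁u₁≢u₁ (trans (cong (to t₁) (sym su≡u₁)) (trans (sym (to-from s _)) (trans (cong (to s) e) su≡u₁)))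

  ActiveAt⇒suppBlock : ∀ {M} → MinimalNormal M N → ∀ {x} → ActiveAt M x → ∀ {y} → β y ≡ β x → supp M y
  ActiveAt⇒suppBlock {M} M-min {x} active {y} p =
    supp-Conjugate⁻ (invP (carry x))
      (supp-Induced⁻ (supp-mono (T⊆restriction (Pulled x M) (proj₁ (Pulled-minimalNormal x M-min)) (ActiveAt-pull x active))
                                (T-moves (from (carry x) y , pull x p))))

  -- If M ∩ M' = 1 then M' centralises M, so M' fixes the block of x pointwise.
  ActiveAt-⊆ : ∀ {M M'} → MinimalNormal M N → MinimalNormal M' N → ∀ {x} → ActiveAt M x → ActiveAt M' x → M ⊆ M'
  ActiveAt-⊆ {M} {M'} M-min@(M⊴N , _ , M-minimal) (M'⊴N , _) active (m' , m'∈M' , y , p , m'y≢y)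
    with M-minimal (M ∩ M') (∩-normal M⊴N M'⊴N) (λ _ → proj₁)
  ... | inj₂ M⊆M∩M' = λ g g∈M → proj₂ (M⊆M∩M' g g∈M)
  ... | inj₁ M∩M'≈1 = ⊥-elim (m'y≢y (centralises⇒fixesActiveBlock M-min active (normal⇒⊆ M'⊴N m' m'∈M')
      centralises y p))
    where
      centralises : Centralises m' M
      centralises m m∈M = comm≈id⇒commute m' m
        (disjoint-normal⇒comm≈id M'⊴N M⊴N (λ g (g∈M' , g∈M) → M∩M'≈1 g (g∈M , g∈M')) m'∈M' m∈M)

  ∃minimalNormal-supp : ∀ x → Σ[ M ∈ PSet (Fin n) lzero ] (MinimalNormal M N × supp M x)
  ∃minimalNormal-supp x with FinN.minimalNormal⊆ em N≤ N N⊴N N-nontrivial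
    where
      N⊴N : IsNormal N N
      N⊴N = N≤ , (λ _ g∈N → g∈N) , λ _ _ → conj-closed N≤

      N-nontrivial : NonTrivial N
      N-nontrivial = let g , g∈N , r = T⊆N↾b₀ t₁ t₁∈T in
        g , g∈N , λ g≈id → t₁≉id (FixesBlock⇒Restricts-id {g = g} {t₁} r λ y _ → g≈id y)
  ... | M , M-min@(_ , (m , m∈M , m≉id) , _) , _ with ≉idP⇒moves em Fin._≟_ m m≉id
  ...   | y , my≢y with G-transitive y x
  ...     | h , h∈G , hy≡x =
    Conjugate h M , Conjugate-minimalNormal G≤ N⊴G h∈G M-min ,
        subst (supp (Conjugate h M)) hy≡x (supp-Conjugate⁺ h (m , m∈M , my≢y))

  abstract
    MinimalNormalAt : Fin n → PSet (Fin n) lzero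
    MinimalNormalAt x = proj₁ (∃minimalNormal-supp x)

    MinimalNormalAt-minimalNormal : ∀ x → MinimalNormal (MinimalNormalAt x) N
    MinimalNormalAt-minimalNormal x = proj₁ (proj₂ (∃minimalNormal-supp x))

    MinimalNormalAt-supp : ∀ x → supp (MinimalNormalAt x) x
    MinimalNormalAt-supp x = proj₂ (proj₂ (∃minimalNormal-supp x))

  minimalNormal-supp-⊆ : ∀ {M M'} → MinimalNormal M N → MinimalNormal M' N → ∀ {x} → supp M x → supp M' x → M ⊆ M'
  minimalNormal-supp-⊆ M-min M'-min x∈suppM x∈suppM' =
    ActiveAt-⊆ M-min M'-min (supp⇒ActiveAt x∈suppM) (supp⇒ActiveAt x∈suppM')

  private
    SameFactor : Fin n → Fin n → Set
    SameFactor x = supp (MinimalNormalAt x)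

    SameFactor-sym : ∀ {x y} → SameFactor x y → SameFactor y x
    SameFactor-sym {x} {y} y∈supp =
      supp-mono (minimalNormal-supp-⊆ (MinimalNormalAt-minimalNormal x) (MinimalNormalAt-minimalNormal y) y∈supp
                  (MinimalNormalAt-supp y))
                (MinimalNormalAt-supp x)

    module Reps = Representatives SameFactor (λ _ _ → em) MinimalNormalAt-supp SameFactor-sym

  k : ℕ
  k = Reps.#reps (allFin n)

  rep : Fin k → Fin n
  rep = Reps.rep (allFin n)

  Factor : Fin k → PSet (Fin n) lzero
  Factor i = MinimalNormalAt (rep i)

  Factor-minimalNormal : ∀ i → MinimalNormal (Factor i) N
  Factor-minimalNormal i = MinimalNormalAt-minimalNormal (rep i)

  Factor≤ : ∀ i → IsSubgroup (Factor i)
  Factor≤ i = normal⇒subgroup (proj₁ (Factor-minimalNormal i))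

  Factor⊆N : ∀ i → Factor i ⊆ N
  Factor⊆N i = normal⇒⊆ (proj₁ (Factor-minimalNormal i))

  rep∈supp : ∀ i → supp (Factor i) (rep i)
  rep∈supp i = MinimalNormalAt-supp (rep i)

  rep-active : ∀ i → ActiveAt (Factor i) (rep i)
  rep-active i = supp⇒ActiveAt (rep∈supp i)

  factorAt : ∀ x → Σ[ i ∈ Fin k ] supp (Factor i) x
  factorAt x = Reps.rep-covers (allFin n) (∈-allFin x)

  supp-Factor-disjoint : ∀ i j {x} → supp (Factor i) x → supp (Factor j) x → i ≡ j
  supp-Factor-disjoint i j x∈suppᵢ x∈suppⱼ = sym (Reps.rep-unique (allFin n) j i
    (supp-mono (minimalNormal-supp-⊆ (Factor-minimalNormal i) (Factor-minimalNormal j) x∈suppᵢ x∈suppⱼ) (rep∈supp i)))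

  minimalNormal⊆Factor : ∀ {M} → MinimalNormal M N → ∀ i → supp M (rep i) → M ⊆ Factor i
  minimalNormal⊆Factor M-min i r∈supp = minimalNormal-supp-⊆ M-min (Factor-minimalNormal i) r∈supp (rep∈supp i)

  Factor-fixes-other : ∀ i j → i ≢ j → ∀ {m} → Factor i m → ∀ x → supp (Factor j) x → to m x ≡ x
  Factor-fixes-other i j i≢j m∈Fᵢ x x∈suppⱼ = ¬supp⇒fixed Fin._≟_ m∈Fᵢ
      λ x∈suppᵢ → i≢j (supp-Factor-disjoint i j x∈suppᵢ x∈suppⱼ)

  HasProjection : Fin k → Perm (Fin n) → Set
  HasProjection j g = Σ[ m ∈ Perm (Fin n) ] (Factor j m × AgreeOn (supp (Factor j)) m g)

  HasProjection-isSubgroup : ∀ j → IsSubgroup (HasProjection j)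
  HasProjection-isSubgroup j = record
    { resp       = λ e (m , m∈F , agree) → m , m∈F , λ x s → trans (agree x s) (e x)
    ; has-id     = idP , has-id , λ _ _ → refl
    ; closed-∘   = λ {g} {g'} (m , m∈F , agree) (m' , m'∈F , agree') → m ∘P m' , closed-∘ m∈F m'∈F ,
                     AgreeOn-∘P (supp (Factor j)) {m} {m'} {g} {g'} (supp-closed Fin._≟_ (Factor≤ j) m'∈F) agree agree'
    ; closed-inv = λ {g} (m , m∈F , agree) → invP m , closed-inv m∈F ,
                     AgreeOn-invP (supp (Factor j)) {m} {g} (supp-closed Fin._≟_ (Factor≤ j) (closed-inv m∈F)) agree
    }
    where open IsSubgroup (Factor≤ j)

  minimalNormal⊆HasProjection : ∀ {M} → MinimalNormal M N → ∀ j → M ⊆ HasProjection j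
  minimalNormal⊆HasProjection {M} M-min j g g∈M with em {supp M (rep j)}
  ... | yes r∈supp = g , minimalNormal⊆Factor M-min j r∈supp g g∈M , λ _ _ → refl
  ... | no r∉supp  = idP , IsSubgroup.has-id (Factor≤ j) , λ x x∈suppⱼ → sym (decidable-stable (_ Fin.≟ _) λ gx≢x →
      r∉supp (supp-mono (minimalNormal-supp-⊆ (Factor-minimalNormal j) M-min x∈suppⱼ (g , g∈M , gx≢x)) (rep∈supp j)))

  Soc⊆HasProjection : ∀ j → Soc N ⊆ HasProjection j
  Soc⊆HasProjection j = Gen-least (HasProjection-isSubgroup j)
      λ g (M , M-min , g∈M) → minimalNormal⊆HasProjection M-min j g g∈M

  prodP-Factor : (t : Fin k → Perm (Fin n)) → (∀ i → Factor i (t i)) →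
      ∀ j x → supp (Factor j) x → to (prodP t) x ≡ to (t j) x
  prodP-Factor t t∈F j = prodP-acts-as-factor (supp (Factor j)) t j
    (λ i i≢j → Factor-fixes-other i j i≢j (t∈F i)) (λ _ → supp-closed Fin._≟_ (Factor≤ j) (t∈F j))

  projections⇒prodP : ∀ g → (∀ j → HasProjection j g) →
      Σ[ t ∈ (Fin k → Perm (Fin n)) ] ((∀ i → Factor i (t i)) × prodP t ≈P g)
  projections⇒prodP g g-proj = t , t∈F , λ x →
    let j , x∈suppⱼ = factorAt x in trans (prodP-Factor t t∈F j x x∈suppⱼ) (proj₂ (proj₂ (g-proj j)) x x∈suppⱼ)
    where
      t = λ j → proj₁ (g-proj j)
      t∈F = λ j → proj₁ (proj₂ (g-proj j))

  -- [g, m] ∈ M fixes the block of x, so it is trivial; hence g centralises M.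
  fixesActiveBlock⇒fixesSupp : ∀ {M} → MinimalNormal M N → ∀ {x} → ActiveAt M x →
    ∀ {g} → N g → FixesBlock g x → ∀ {z} → supp M z → FixesBlock g z
  fixesActiveBlock⇒fixesSupp {M} M-min@(M⊴N , _) {x} active {g} g∈N g-fixes z∈supp =
    centralises⇒fixesActiveBlock M-min (supp⇒ActiveAt z∈supp) g∈N centralises
    where
      centralises : Centralises g M
      centralises m m∈M = comm≈id⇒commute g m
          (fixesActiveBlock⇒≈id M-min active (normal-commˡ M⊴N g∈N m∈M) comm-fixes)
        where
          m-blocks : ∀ y → β (from m y) ≡ β y
          m-blocks = proj₂ (normal⇒⊆ M⊴N _ (IsSubgroup.closed-inv (normal⇒subgroup M⊴N) m∈M))
          comm-fixes : FixesBlock (comm g m) x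
          comm-fixes y p = trans (cong (λ w → to g (to m w)) (from-fixed g (g-fixes (from m y) (trans (m-blocks y) p))))
                                 (trans (cong (to g) (to-from m y)) (g-fixes y p))

  Preimage : (b : Fin n) → PSet (Blk β b) lzero → PSet (Fin n) lzero
  Preimage b K g = N g × Σ[ σ ∈ Perm (Blk β b) ] (K σ × Restricts β b g σ)

  Preimage-normal : ∀ {b K} → IsNormal K (N↾ b) → IsNormal (Preimage b K) N
  Preimage-normal {b} {K} K⊴N↾b = P-isSubgroup , (λ _ → proj₁) , P-conj
    where
      open IsSubgroup (normal⇒subgroup K⊴N↾b)

      P-isSubgroup : IsSubgroup (Preimage b K)
      P-isSubgroup = record
        { resp       = λ {g} {h} e (g∈N , σ , σ∈K , r) → IsSubgroup.resp N≤ e g∈N , σ , σ∈K ,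
            Restricts-respˡ {g = g} {h} {σ} e r
        ; has-id     = IsSubgroup.has-id N≤ , idP , has-id , Restricts-id
        ; closed-∘   = λ {g} {h} (g∈N , σ , σ∈K , r) (h∈N , τ , τ∈K , s) →
                         IsSubgroup.closed-∘ N≤ g∈N h∈N , σ ∘P τ , closed-∘ σ∈K τ∈K , Restricts-∘ {g = g} {h} σ τ r s
        ; closed-inv = λ {g} (g∈N , σ , σ∈K , r) → IsSubgroup.closed-inv N≤ g∈N ,
            invP σ , closed-inv σ∈K , Restricts-inv {g = g} σ r
        }

      P-conj : ∀ c h → N c → Preimage b K h → Preimage b K (conj c h)
      P-conj c h c∈N (h∈N , σ , σ∈K , r) =
          conj-closed N≤ c∈N h∈N , conj c↾ σ , normal-conj K⊴N↾b {c↾} (c , c∈N , λ _ → refl) σ∈K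
        , Restricts-conj {g = c} {h} c↾ σ (λ _ → refl) r
        where c↾ = restrict c (proj₂ c∈N) b

  restriction-minimalNormal : ∀ {M} → MinimalNormal M N → ∀ {b} → ActiveAt M b → MinimalNormal (Induced M β b) (N↾ b)
  restriction-minimalNormal {M} (M⊴N , _ , M-minimal) {b} (m , m∈M , y , p , my≢y) =
    Induced-normal M⊴N b , (restrict m (proj₂ (normal⇒⊆ M⊴N m m∈M)) b , (m , m∈M , λ _ → refl) ,
        λ e → my≢y (cong proj₁ (e (y , p)))) ,
    minimal
    where
      minimal : ∀ K → IsNormal K (N↾ b) → K ⊆ Induced M β b → Trivial K ⊎ (Induced M β b ⊆ K)
      minimal K K⊴N↾b K⊆M↾b with M-minimal (M ∩ Preimage b K)
          (∩-normal M⊴N (Preimage-normal K⊴N↾b)) (λ _ → proj₁)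
      ... | inj₁ trivial = inj₁ λ σ σ∈K → let g , g∈M , r = K⊆M↾b σ σ∈K in
        FixesBlock⇒Restricts-id {g = g} {σ} r λ z _ → trivial g (g∈M , normal⇒⊆ M⊴N g g∈M , σ , σ∈K , r) z
      ... | inj₂ M⊆ = inj₂ λ σ (g , g∈M , r) → let _ , _ , σ' , σ'∈K , r' = M⊆ g g∈M in
        IsSubgroup.resp (normal⇒subgroup K⊴N↾b) (Restricts-unique {g = g} {σ'} {σ} r' r) σ'∈K

  -- If K ∩ M↾b = 1, a preimage ν of κ ∈ K centralises M (each [ν, m] ∈ M fixes the block of b), so κ = 1.
  minimalNormal↾⊆ : ∀ {M} → MinimalNormal M N → ∀ {b} → ActiveAt M b →
    ∀ {K} → MinimalNormal K (N↾ b) → K ⊆ Induced M β b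
  minimalNormal↾⊆ {M} M-min@(M⊴N , _) {b} active {K} (K⊴N↾b , (κ , κ∈K , κ≉id) , K-minimal)
    with K-minimal (K ∩ Induced M β b) (∩-normal K⊴N↾b (Induced-normal M⊴N b)) (λ _ → proj₁)
  ... | inj₂ K⊆ = λ σ σ∈K → proj₂ (K⊆ σ σ∈K)
  ... | inj₁ K∩M↾b≈1 = ⊥-elim (κ≉id (FixesBlock⇒Restricts-id {g = ν} {κ} r
      (centralises⇒fixesActiveBlock M-min active ν∈N centralises)))
    where
      ν : Perm (Fin n)
      ν = proj₁ (normal⇒⊆ K⊴N↾b κ κ∈K)
      ν∈N : N ν
      ν∈N = proj₁ (proj₂ (normal⇒⊆ K⊴N↾b κ κ∈K))
      r : Restricts β b ν κ
      r = proj₂ (proj₂ (normal⇒⊆ K⊴N↾b κ κ∈K))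

      centralises : Centralises ν M
      centralises m m∈M = comm≈id⇒commute ν m
        (fixesActiveBlock⇒≈id M-min active (normal-commˡ M⊴N ν∈N m∈M)
          (Restricts-id⇒FixesBlock {g = comm ν m} {comm κ μ} (Restricts-comm {g = ν} {m} κ μ r (λ _ → refl))
            (disjoint-normal⇒comm≈id K⊴N↾b (Induced-normal M⊴N b) K∩M↾b≈1 {κ} {μ} κ∈K (m , m∈M , λ _ → refl))))
        where μ = restrict m (proj₂ (normal⇒⊆ M⊴N m m∈M)) b

  Soc↾⊆ : ∀ {M} → MinimalNormal M N → ∀ {b} → ActiveAt M b → Soc (N↾ b) ⊆ Induced M β b
  Soc↾⊆ {M} M-min@(M⊴N , _) {b} active = Gen-least (Induced-isSubgroup (normal⇒subgroup M⊴N) b)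
    λ σ (K , K-min , σ∈K) → minimalNormal↾⊆ M-min active K-min σ σ∈K

  Tᵢ : Fin k → PSet (Fin n) (lsuc lzero)
  Tᵢ i g = Lift (lsuc lzero) (Factor i g)

  supp-Tᵢ⁺ : ∀ i {x} → supp (Factor i) x → supp (Tᵢ i) x
  supp-Tᵢ⁺ i = supp-mono λ _ → lift

  supp-Tᵢ⁻ : ∀ i {x} → supp (Tᵢ i) x → supp (Factor i) x
  supp-Tᵢ⁻ i = supp-mono λ _ → lower

  prodP-unique : (t t' : Fin k → Perm (Fin n)) → (∀ i → Factor i (t i)) → (∀ i → Factor i (t' i)) →
    prodP t ≈P prodP t' → ∀ i → t i ≈P t' i
  prodP-unique t t' t∈F t'∈F t≈t' i x with em {supp (Factor i) x}
  ... | yes x∈supp = trans (sym (prodP-Factor t t∈F i x x∈supp)) (trans (t≈t' x) (prodP-Factor t' t'∈F i x x∈supp))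
  ... | no x∉supp  = trans (¬supp⇒fixed Fin._≟_ (t∈F i) x∉supp) (sym (¬supp⇒fixed Fin._≟_ (t'∈F i) x∉supp))

  Soc-directProduct : InternalDirectProduct (Soc N) Tᵢ
  Soc-directProduct =
      (λ i → Lift-isSubgroup (Factor≤ i))
    , (λ i g (lift g∈F) → gen (Factor i , Factor-minimalNormal i , g∈F))
    , (λ i j i≢j a b (lift a∈F) (lift b∈F) → disjointSupp⇒commute Fin._≟_ (Factor≤ i) (Factor≤ j)
         (λ x∈suppᵢ x∈suppⱼ → i≢j (supp-Factor-disjoint i j x∈suppᵢ x∈suppⱼ)) a∈F b∈F)
    , (λ g g∈Soc → let t , t∈F , t≈g = projections⇒prodP g (λ j → Soc⊆HasProjection j g g∈Soc) in
         t , (λ i → lift (t∈F i)) , t≈g)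
    , λ t t' t∈T t'∈T → prodP-unique t t' (lower ∘ t∈T) (lower ∘ t'∈T)

  Factor-conj : ∀ {g} → G g → ∀ i → Σ[ j ∈ Fin k ] (∀ x → supp (Factor i) x iff supp (Factor j) (to g x))
  Factor-conj {g} g∈G i = j ,
    λ x → (λ x∈suppᵢ → supp-mono gFg⁻¹⊆Fⱼ (supp-Conjugate⁺ g x∈suppᵢ)) ,
          (λ gx∈suppⱼ → supp-Conjugate⁻ g (supp-mono Fⱼ⊆gFg⁻¹ gx∈suppⱼ))
    where
      j = proj₁ (factorAt (to g (rep i)))
      gr∈suppⱼ : supp (Factor j) (to g (rep i))
      gr∈suppⱼ = proj₂ (factorAt (to g (rep i)))
      gFg⁻¹-min : MinimalNormal (Conjugate g (Factor i)) N
      gFg⁻¹-min = Conjugate-minimalNormal G≤ N⊴G g∈G (Factor-minimalNormal i)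
      gr∈supp : supp (Conjugate g (Factor i)) (to g (rep i))
      gr∈supp = supp-Conjugate⁺ g (rep∈supp i)
      gFg⁻¹⊆Fⱼ : Conjugate g (Factor i) ⊆ Factor j
      gFg⁻¹⊆Fⱼ = minimalNormal-supp-⊆ gFg⁻¹-min (Factor-minimalNormal j) gr∈supp gr∈suppⱼ
      Fⱼ⊆gFg⁻¹ : Factor j ⊆ Conjugate g (Factor i)
      Fⱼ⊆gFg⁻¹ = minimalNormal-supp-⊆ (Factor-minimalNormal j) gFg⁻¹-min gr∈suppⱼ gr∈supp

  supp-blockSystem : IsIndexedBlockSystem G (λ i → supp (Tᵢ i))
  supp-blockSystem =
      (λ i → rep i , supp-Tᵢ⁺ i (rep∈supp i))
    , (λ x → let i , x∈suppᵢ = factorAt x in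
         i , supp-Tᵢ⁺ i x∈suppᵢ , λ j x∈suppⱼ → supp-Factor-disjoint j i (supp-Tᵢ⁻ j x∈suppⱼ) x∈suppᵢ)
    , λ g g∈G i → let j , ↔ = Factor-conj g∈G i in
         j , λ x → (supp-Tᵢ⁺ j ∘ proj₁ (↔ x) ∘ supp-Tᵢ⁻ i) , (supp-Tᵢ⁺ i ∘ proj₂ (↔ x) ∘ supp-Tᵢ⁻ j)

  β-refines-supp : Refines β (λ i → supp (Tᵢ i))
  β-refines-supp i x y βx≡βy x∈supp =
    supp-Tᵢ⁺ i (ActiveAt⇒suppBlock (Factor-minimalNormal i) (supp⇒ActiveAt (supp-Tᵢ⁻ i x∈supp)) (sym βx≡βy))

  PtStab-block≡PtStab-supp : ∀ i (b : Fin n) → (∀ y → β y ≡ β b → supp (Tᵢ i) y) →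
    SameSet (PtStab N (λ y → β y ≡ β b)) (PtStab N (supp (Tᵢ i)))
  PtStab-block≡PtStab-supp i b block⊆supp =
      (λ g (g∈N , g-fixes) → g∈N , λ z z∈supp →
         fixesActiveBlock⇒fixesSupp (Factor-minimalNormal i) b-active g∈N g-fixes (supp-Tᵢ⁻ i z∈supp) z refl)
    , λ g (g∈N , g-fixes) → g∈N , λ y p → g-fixes y (block⊆supp y p)
    where b-active = supp⇒ActiveAt (supp-Tᵢ⁻ i (block⊆supp b refl))

  PtStab-supp∩Tᵢ-trivial : ∀ i → Trivial (λ g → PtStab N (supp (Tᵢ i)) g × Tᵢ i g)
  PtStab-supp∩Tᵢ-trivial i g ((_ , g-fixes) , lift g∈F) x with em {supp (Factor i) x}
  ... | yes x∈supp = g-fixes x (supp-Tᵢ⁺ i x∈supp)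
  ... | no x∉supp  = ¬supp⇒fixed Fin._≟_ g∈F x∉supp

  Soc-iff-local : ∀ g → N g →
    Soc N g iff (∀ (b : Fin n) → Σ[ σ ∈ Perm (Blk β b) ] (Restricts β b g σ × Soc (N↾ b) σ))
  Soc-iff-local g g∈N = local , global
    where
      local : Soc N g → ∀ b → Σ[ σ ∈ Perm (Blk β b) ] (Restricts β b g σ × Soc (N↾ b) σ)
      local g∈Soc b = g↾ , (λ _ → refl) ,
          gres {g = m↾} m↾≈g↾ (gen (Induced (Factor j) β b ,
                restriction-minimalNormal (Factor-minimalNormal j) b-active , m , m∈F , λ _ → refl))
        where
          j = proj₁ (factorAt b)
          b-active = supp⇒ActiveAt (proj₂ (factorAt b))
          m = proj₁ (Soc⊆HasProjection j g g∈Soc)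
          m∈F = proj₁ (proj₂ (Soc⊆HasProjection j g g∈Soc))
          g↾ = restrict g (proj₂ g∈N) b
          m↾ = restrict m (proj₂ (Factor⊆N j m m∈F)) b
          m↾≈g↾ : m↾ ≈P g↾
          m↾≈g↾ (y , p) = Blk-≡ (proj₂ (proj₂ (Soc⊆HasProjection j g g∈Soc)) y
                                 (ActiveAt⇒suppBlock (Factor-minimalNormal j) b-active p))

      -- On supp (Factor j), g agrees with a preimage m ∈ Factor j of its restriction to the block of rep j,
      -- because m⁻¹g fixes that active block.
      global : (∀ b → Σ[ σ ∈ Perm (Blk β b) ] (Restricts β b g σ × Soc (N↾ b) σ)) → Soc N g
      global g-local = let t , t∈F , t≈g = projections⇒prodP g g-proj in
        gres t≈g (prodP-closed Gen-isSubgroup t λ i → gen (Factor i , Factor-minimalNormal i , t∈F i))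
        where
          g-proj : ∀ j → HasProjection j g
          g-proj j = m , m∈F , λ x x∈supp →
            sym (trans (sym (to-from m (to g x)))
                       (cong (to m) (fixesActiveBlock⇒fixesSupp (Factor-minimalNormal j) (rep-active j)
                           m⁻¹g∈N m⁻¹g-fixes x∈supp x refl)))
            where
              b = rep j
              σ = proj₁ (g-local b)
              r = proj₁ (proj₂ (g-local b))
              m↾ = Soc↾⊆ (Factor-minimalNormal j) (rep-active j) σ (proj₂ (proj₂ (g-local b)))
              m = proj₁ m↾
              m∈F = proj₁ (proj₂ m↾)
              m⁻¹g∈N = IsSubgroup.closed-∘ N≤ (IsSubgroup.closed-inv N≤ (Factor⊆N j m m∈F)) g∈N
              m⁻¹g-fixes : FixesBlock (invP m ∘P g) b
              m⁻¹g-fixes y p = trans (cong (from m) (trans (sym (r (y , p))) (proj₂ (proj₂ m↾) (y , p)))) (from-to m y)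

  agreeOnActiveBlock⇒≈ : ∀ {M} → MinimalNormal M N → ∀ {x} → ActiveAt M x → ∀ {a b} → M a → M b →
    (∀ y → β y ≡ β x → to a y ≡ to b y) → a ≈P b
  agreeOnActiveBlock⇒≈ M-min@(M⊴N , _) active {a} {b} a∈M b∈M agree z =
    trans (sym (to-from b (to a z))) (cong (to b) (b⁻¹a≈id z))
    where
      open IsSubgroup (normal⇒subgroup M⊴N)
      b⁻¹a≈id : (invP b ∘P a) ≈P idP
      b⁻¹a≈id = fixesActiveBlock⇒≈id M-min active (closed-∘ (closed-inv b∈M) a∈M)
                  λ y p → trans (cong (from b) (agree y p)) (from-to b y)

  module Local (j : Fin k) where

    h : Perm (Fin n)
    h = carry (rep j)

    Factor₀ : PSet (Fin n) lzero
    Factor₀ = Pulled (rep j) (Factor j)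

    Factor₀-minimalNormal : MinimalNormal Factor₀ N
    Factor₀-minimalNormal = Pulled-minimalNormal (rep j) (Factor-minimalNormal j)

    Factor₀-active : ActiveAt Factor₀ b₀
    Factor₀-active = ActiveAt-pull (rep j) (rep-active j)

    pulled∈N : ∀ {m} → Factor j m → N (conj (invP h) m)
    pulled∈N m∈F = normal-conj N⊴G (carry⁻¹∈G (rep j)) (Factor⊆N j _ m∈F)

    localise : ∀ m → Factor j m → Perm (Blk β b₀)
    localise m m∈F = restrict (conj (invP h) m) (proj₂ (pulled∈N m∈F)) b₀

    localise∈T : ∀ m (m∈F : Factor j m) → T (localise m m∈F)
    localise∈T m m∈F = gen (Induced Factor₀ β b₀ , restriction-minimalNormal Factor₀-minimalNormal Factor₀-active ,
                              conj (invP h) m , (m , m∈F , λ _ → refl) , λ _ → refl)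

    localisations-agree⇒agree : ∀ {a b} {σ σ' : Perm (Blk β b₀)} →
      Restricts β b₀ (conj (invP h) a) σ → Restricts β b₀ (conj (invP h) b) σ' → σ ≈P σ' →
      ∀ y → β y ≡ β (rep j) → to a y ≡ to b y
    localisations-agree⇒agree {a} {b} r r' σ≈σ' y p =
      trans (sym (cong (to a) (to-from h y)))
        (trans (to-injective (invP h) (trans (sym (r u)) (trans (cong proj₁ (σ≈σ' u)) (r' u))))
               (cong (to b) (to-from h y)))
      where u = from h y , pull (rep j) p

    localisations-agree⇒≈ : ∀ {a b} {σ σ' : Perm (Blk β b₀)} → Factor j a → Factor j b →
      Restricts β b₀ (conj (invP h) a) σ → Restricts β b₀ (conj (invP h) b) σ' → σ ≈P σ' → a ≈P b
    localisations-agree⇒≈ {a} {b} {σ} {σ'} a∈F b∈F r r' σ≈σ' =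
      agreeOnActiveBlock⇒≈ (Factor-minimalNormal j) (rep-active j) a∈F b∈F
        (localisations-agree⇒agree {a} {b} {σ} {σ'} r r' σ≈σ')

    Tᵢ-Iso-T : Iso (Tᵢ j) T
    Tᵢ-Iso-T = record
      { φ      = λ g (lift g∈F) → localise g g∈F
      ; φ-mem  = λ g (lift g∈F) → localise∈T g g∈F
      ; φ-resp = λ g g' _ _ g≈g' u → Blk-≡ (cong (from h) (g≈g' (to h (proj₁ u))))
      ; φ-hom  = λ g g' _ _ _ u → Blk-≡ (cong (λ z → from h (to g z)) (sym (to-from h _)))
      ; φ-inj  = λ g g' (lift g∈F) (lift g'∈F) →
                   localisations-agree⇒≈ {g} {g'} {localise g g∈F} {localise g' g'∈F}
                       g∈F g'∈F (λ _ → refl) (λ _ → refl)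
      ; φ-surj = surj
      }
      where
        surj : ∀ τ → T τ → Σ[ g ∈ Perm (Fin n) ] Σ[ p ∈ Tᵢ j g ] (localise g (lower p) ≈P τ)
        surj τ τ∈T =
          let _ , (m , m∈F , m'≈) , r = T⊆restriction Factor₀ (proj₁ Factor₀-minimalNormal) Factor₀-active τ τ∈T in
          m , lift m∈F , λ u → Blk-≡ (sym (trans (r u) (m'≈ (proj₁ u))))

  semiregular-Iso-Induced : {X : PSet (Fin n) lzero} → IsSubgroup X → X ⊆ N → Semiregular X → Iso X (Induced X β b₀)
  semiregular-Iso-Induced {X} X≤ X⊆N X-semiregular = record
    { φ      = λ u u∈X → restrict u (proj₂ (X⊆N u u∈X)) b₀
    ; φ-mem  = λ u u∈X → u , u∈X , λ _ → refl
    ; φ-resp = λ u u' _ _ u≈u' w → Blk-≡ (u≈u' (proj₁ w))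
    ; φ-hom  = λ u u' _ _ _ w → Blk-≡ refl
    ; φ-inj  = λ u u' u∈X u'∈X u↾≈u'↾ → semiregular-agree⇒≈ X≤ X-semiregular u∈X u'∈X b₀
        (cong proj₁ (u↾≈u'↾ (b₀ , refl)))
    ; φ-surj = λ κ (u , u∈X , r) → u , u∈X ,
        Restricts-unique {g = u} {restrict u (proj₂ (X⊆N u u∈X)) b₀} {κ} (λ _ → refl) r
    }

  module Projection (X : PSet (Fin n) lzero) (X≤ : IsSubgroup X) (X⊆Soc : X ⊆ Soc N) (X-semiregular : Semiregular X)
      (j : Fin k) where
    open Local j
    private
      module X = IsSubgroup X≤
      module F = IsSubgroup (Factor≤ j)

    X⊆N : X ⊆ N
    X⊆N u u∈X = Soc⊆ N≤ u (X⊆Soc u u∈X)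

    Xⱼ : PSet (Fin n) lzero
    Xⱼ m = Σ[ u ∈ Perm (Fin n) ] (X u × Factor j m × AgreeOn (supp (Factor j)) m u)

    Xⱼ⊆Factor : ∀ {m} → Xⱼ m → Factor j m
    Xⱼ⊆Factor (_ , _ , m∈F , _) = m∈F

    Xⱼ-resp : ∀ {m m'} → m ≈P m' → Xⱼ m → Xⱼ m'
    Xⱼ-resp m≈m' (u , u∈X , m∈F , agree) = u , u∈X , F.resp m≈m' m∈F , λ x s → trans (sym (m≈m' x)) (agree x s)

    Xⱼ-project : ∀ u → X u → Σ[ m ∈ Perm (Fin n) ] Xⱼ m
    Xⱼ-project u u∈X = let m , m∈F , agree = Soc⊆HasProjection j u (X⊆Soc u u∈X) in m , u , u∈X , m∈F , agree

    W : PSet (Blk β b₀) lzero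
    W σ = Σ[ m ∈ Perm (Fin n) ] (Xⱼ m × Restricts β b₀ (conj (invP h) m) σ)

    W-isSubgroup : IsSubgroup W
    W-isSubgroup = record
      { resp       = λ {σ} {σ'} σ≈σ' (m , m∈Xⱼ , r) → m , m∈Xⱼ , Restricts-respʳ {g = conj (invP h) m} σ σ' σ≈σ' r
      ; has-id     = idP , (idP , X.has-id , F.has-id , λ _ _ → refl) , λ u → sym (from-to h (proj₁ u))
      ; closed-∘   = λ {σ} {σ'} (m , (u , u∈X , m∈F , agree) , r) (m' , (u' , u'∈X , m'∈F , agree') , r') →
            m ∘P m'
          , (u ∘P u' , X.closed-∘ u∈X u'∈X , F.closed-∘ m∈F m'∈F ,
             AgreeOn-∘P (supp (Factor j)) {m} {m'} {u} {u'} (supp-closed Fin._≟_ (Factor≤ j) m'∈F) agree agree')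
          , Restricts-respˡ {g = conj (invP h) m ∘P conj (invP h) m'} {conj (invP h) (m ∘P m')} {σ ∘P σ'}
              (λ x → sym (conj-∘P (invP h) m m' x))
              (Restricts-∘ {g = conj (invP h) m} {conj (invP h) m'} σ σ' r r')
      ; closed-inv = λ {σ} (m , (u , u∈X , m∈F , agree) , r) →
            invP m
          , (invP u , X.closed-inv u∈X , F.closed-inv m∈F ,
             AgreeOn-invP (supp (Factor j)) {m} {u} (supp-closed Fin._≟_ (Factor≤ j) (F.closed-inv m∈F)) agree)
          , Restricts-inv {g = conj (invP h) m} σ r
      }

    W⊆T : W ⊆ T
    W⊆T σ (m , (_ , _ , m∈F , _) , r) =
      gen (Induced Factor₀ β b₀ , restriction-minimalNormal Factor₀-minimalNormal Factor₀-active ,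
           conj (invP h) m , (m , m∈F , λ _ → refl) , r)

    -- A point of B₀ fixed by σ = (h⁻¹mh)↾B₀ gives a point of supp (Factor j) fixed by m, hence by u ∈ X.
    W-semiregular : Semiregular W
    W-semiregular σ y (m , (u , u∈X , m∈F , agree) , r) σy≡y w =
      Blk-≡ (trans (r w) (trans (cong (from h) (m≈id (to h (proj₁ w)))) (from-to h _)))
      where
        z = to h (proj₁ y)
        z∈supp : supp (Factor j) z
        z∈supp = ActiveAt⇒suppBlock (Factor-minimalNormal j) (rep-active j) (push (rep j) (proj₂ y))
        mz≡z : to m z ≡ z
        mz≡z = to-injective (invP h) (trans (sym (r y)) (trans (cong proj₁ σy≡y) (sym (from-to h (proj₁ y)))))
        u≈id : u ≈P idP
        u≈id = X-semiregular u z u∈X (trans (sym (agree z z∈supp)) mz≡z)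
        m≈id : m ≈P idP
        m≈id x with em {supp (Factor j) x}
        ... | yes x∈supp = trans (agree x x∈supp) (u≈id x)
        ... | no x∉supp  = ¬supp⇒fixed Fin._≟_ m∈F x∉supp

    W-witness-unique : ∀ {σ σ'} (p : W σ) (p' : W σ') → σ ≈P σ' →
        proj₁ (proj₁ (proj₂ p)) ≈P proj₁ (proj₁ (proj₂ p'))
    W-witness-unique {σ} {σ'} (m , (u , u∈X , m∈F , agree) , r) (m' , (u' , u'∈X , m'∈F , agree') , r') σ≈σ' =
      semiregular-agree⇒≈ X≤ X-semiregular u∈X u'∈X (rep j)
        (trans (sym (agree (rep j) (rep∈supp j)))
          (trans (localisations-agree⇒≈ {m} {m'} {σ} {σ'} m∈F m'∈F r r' σ≈σ' (rep j)) (agree' (rep j) (rep∈supp j))))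

    W-Iso-X : Iso W X
    W-Iso-X = record
      { φ      = λ σ p → proj₁ (proj₁ (proj₂ p))
      ; φ-mem  = λ σ p → proj₁ (proj₂ (proj₁ (proj₂ p)))
      ; φ-resp = λ σ σ' p p' → W-witness-unique {σ} {σ'} p p'
      ; φ-hom  = λ σ σ' p q r → W-witness-unique {σ ∘P σ'} {σ ∘P σ'} r
          (IsSubgroup.closed-∘ W-isSubgroup {σ} {σ'} p q) (λ _ → refl)
      ; φ-inj  = inj
      ; φ-surj = λ u u∈X → let m , m∈Xⱼ = Xⱼ-project u u∈X in
                   localise m (Xⱼ⊆Factor m∈Xⱼ) , (m , m∈Xⱼ , λ _ → refl) , λ _ → refl
      }
      where
        inj : ∀ σ σ' (p : W σ) (p' : W σ') → proj₁ (proj₁ (proj₂ p)) ≈P proj₁ (proj₁ (proj₂ p')) → σ ≈P σ'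
        inj σ σ' (m , (u , _ , _ , agree) , r) (m' , (u' , _ , _ , agree') , r') u≈u' w =
          Blk-≡ (trans (r w) (trans (cong (from h) (trans (agree z z∈supp) (trans (u≈u' z) (sym (agree' z z∈supp)))))
              (sym (r' w))))
          where
            z = to h (proj₁ w)
            z∈supp = ActiveAt⇒suppBlock (Factor-minimalNormal j) (rep-active j) (push (rep j) (proj₂ w))

  SemiregularConjugacy : PSet (Fin n) lzero → Set₁
  SemiregularConjugacy U = ∀ (W₁ W₂ : PSet (Blk β b₀) lzero) → IsSubgroup W₁ → IsSubgroup W₂ → W₁ ⊆ T → W₂ ⊆ T →
    Semiregular W₁ → Semiregular W₂ → Iso W₁ (Induced U β b₀) → Iso W₂ (Induced U β b₀) → ConjugateIn T W₁ W₂

  Orbit : PSet (Fin n) lzero → Fin n → Fin n → Set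
  Orbit U x y = Σ[ u ∈ Perm (Fin n) ] (U u × to u x ≡ y)

  module Conjugation (U V : PSet (Fin n) lzero) (U≤ : IsSubgroup U) (V≤ : IsSubgroup V)
      (U⊆Soc : U ⊆ Soc N) (V⊆Soc : V ⊆ Soc N) (U-semiregular : Semiregular U) (V-semiregular : Semiregular V)
      (U≅V : Iso U V) (conjugacy : SemiregularConjugacy U) where

    module AtFactor (j : Fin k) where
      open Local j
      module Uⱼ = Projection U U≤ U⊆Soc U-semiregular j
      module Vⱼ = Projection V V≤ V⊆Soc V-semiregular j

      abstract
        W-conjugate : ConjugateIn T Uⱼ.W Vⱼ.W
        W-conjugate = conjugacy Uⱼ.W Vⱼ.W Uⱼ.W-isSubgroup Vⱼ.W-isSubgroup Uⱼ.W⊆T Vⱼ.W⊆T Uⱼ.W-semiregular Vⱼ.W-semiregular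
          (Iso-trans (IsSubgroup.resp U≤) Uⱼ.W-Iso-X U≅U↾)
          (Iso-trans (IsSubgroup.resp V≤) Vⱼ.W-Iso-X (Iso-trans (IsSubgroup.resp U≤) (Iso-sym U≤ U≅V) U≅U↾))
          where
            U≅U↾ : Iso U (Induced U β b₀)
            U≅U↾ = semiregular-Iso-Induced U≤ Uⱼ.X⊆N U-semiregular

      τ : Perm (Blk β b₀)
      τ = proj₁ W-conjugate

      abstract
        τ-lift : Induced Factor₀ β b₀ τ
        τ-lift = T⊆restriction Factor₀ (proj₁ Factor₀-minimalNormal) Factor₀-active τ (proj₁ (proj₂ W-conjugate))

      -- d ∈ Factor j localises to τ, so conjugation by d carries Uⱼ onto Vⱼ.
      d : Perm (Fin n)
      d = proj₁ (proj₁ (proj₂ τ-lift))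

      d∈F : Factor j d
      d∈F = proj₁ (proj₂ (proj₁ (proj₂ τ-lift)))

      Restricts-conj-d : ∀ m w → Restricts β b₀ (conj (invP h) m) w → Restricts β b₀ (conj (invP h) (conj d m)) (conj τ w)
      Restricts-conj-d m w r =
        Restricts-respˡ {g = conj d' (conj (invP h) m)} {conj (invP h) (conj d m)} {conj τ w} d'-pulled
          (Restricts-conj {g = d'} {conj (invP h) m} τ w (proj₂ (proj₂ τ-lift)) r)
        where
          d' : Perm (Fin n)
          d' = proj₁ τ-lift
          d'≈ : d' ≈P conj (invP h) d
          d'≈ = proj₂ (proj₂ (proj₁ (proj₂ τ-lift)))
          d'-pulled : conj d' (conj (invP h) m) ≈P conj (invP h) (conj d m)
          d'-pulled x = trans (d'≈ _) (trans (cong (λ z → from h (to d z)) (to-from h _))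
            (trans (cong (λ z → from h (to d (to m (to h z)))) (invP-cong {g = d'} {g' = conj (invP h) d} d'≈ x))
                   (cong (λ z → from h (to d (to m z))) (to-from h _))))

      conj-d-Uⱼ⊆Vⱼ : ∀ {m} → Uⱼ.Xⱼ m → Vⱼ.Xⱼ (conj d m)
      conj-d-Uⱼ⊆Vⱼ {m} m∈Uⱼ =
        let m₂ , m₂∈Vⱼ , r₂ = proj₂ (proj₂ (proj₂ W-conjugate)) (conj τ w)
              (w , (m , m∈Uⱼ , λ _ → refl) , λ _ → refl) in
        Vⱼ.Xⱼ-resp (localisations-agree⇒≈ {m₂} {conj d m} {conj τ w} {conj τ w}
                      (Vⱼ.Xⱼ⊆Factor m₂∈Vⱼ) dmd⁻¹∈F r₂ (Restricts-conj-d m w λ _ → refl) λ _ → refl)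
                   m₂∈Vⱼ
        where
          w = localise m (Uⱼ.Xⱼ⊆Factor m∈Uⱼ)
          dmd⁻¹∈F = conj-closed (Factor≤ j) d∈F (Uⱼ.Xⱼ⊆Factor m∈Uⱼ)

      Vⱼ⊆conj-d-Uⱼ : ∀ {m'} → Vⱼ.Xⱼ m' → Σ[ m ∈ Perm (Fin n) ] (Uⱼ.Xⱼ m × m' ≈P conj d m)
      Vⱼ⊆conj-d-Uⱼ {m'} m'∈Vⱼ =
        let w₁ , (m , m∈Uⱼ , r₁) , w'≈ = proj₁ (proj₂ (proj₂ W-conjugate)) w' (m' , m'∈Vⱼ , λ _ → refl) in
        m , m∈Uⱼ , localisations-agree⇒≈ {m'} {conj d m} {w'} {conj τ w₁}
                     (Vⱼ.Xⱼ⊆Factor m'∈Vⱼ) (conj-closed (Factor≤ j) d∈F (Uⱼ.Xⱼ⊆Factor m∈Uⱼ))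
                       (λ _ → refl) (Restricts-conj-d m w₁ r₁) w'≈
        where w' = localise m' (Vⱼ.Xⱼ⊆Factor m'∈Vⱼ)

    d : Fin k → Perm (Fin n)
    d j = AtFactor.d j

    δ : Perm (Fin n)
    δ = prodP d

    δ∈N : N δ
    δ∈N = prodP-closed N≤ d λ j → Factor⊆N j (d j) (AtFactor.d∈F j)

    δ-on-Factor : ∀ j x → supp (Factor j) x → to δ x ≡ to (d j) x
    δ-on-Factor = prodP-Factor d AtFactor.d∈F

    δ⁻¹-on-Factor : ∀ j y → supp (Factor j) y → from δ (to (d j) y) ≡ y
    δ⁻¹-on-Factor j y y∈supp = trans (cong (from δ) (sym (δ-on-Factor j y y∈supp))) (from-to δ y)

    -- On the support of the factor containing x, u acts as its projection m, and δ⁻¹vδ as d⁻¹(dmd⁻¹)d = m.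
    module _ (x y : Fin n) where
      private
        j = proj₁ (factorAt x)
        x∈supp = proj₂ (factorAt x)
        module Fⱼ = AtFactor j
        dx∈supp = supp-closed Fin._≟_ (Factor≤ j) Fⱼ.d∈F x∈supp

      Orbit-U⇒δ⁻¹Vδ : Orbit U x y → Σ[ v ∈ Perm (Fin n) ] (V v × to ((invP δ ∘P v) ∘P δ) x ≡ y)
      Orbit-U⇒δ⁻¹Vδ (u , u∈U , ux≡y) = v , v∈V , goal
        where
          m∈Uⱼ = proj₂ (Fⱼ.Uⱼ.Xⱼ-project u u∈U)
          m = proj₁ (Fⱼ.Uⱼ.Xⱼ-project u u∈U)
          dmd⁻¹∈Vⱼ = Fⱼ.conj-d-Uⱼ⊆Vⱼ m∈Uⱼ
          v = proj₁ dmd⁻¹∈Vⱼ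
          v∈V = proj₁ (proj₂ dmd⁻¹∈Vⱼ)
          mx≡y : to m x ≡ y
          mx≡y = trans (proj₂ (proj₂ (proj₂ m∈Uⱼ)) x x∈supp) ux≡y
          y∈supp = subst (supp (Factor j)) mx≡y (supp-closed Fin._≟_ (Factor≤ j) (Fⱼ.Uⱼ.Xⱼ⊆Factor m∈Uⱼ) x∈supp)
          goal : from δ (to v (to δ x)) ≡ y
          goal = trans (cong (λ z → from δ (to v z)) (δ-on-Factor j x x∈supp))
                 (trans (cong (from δ) (sym (proj₂ (proj₂ (proj₂ dmd⁻¹∈Vⱼ)) (to (d j) x) dx∈supp)))
                 (trans (cong (λ z → from δ (to (d j) (to m z))) (from-to (d j) x))
                 (trans (cong (λ z → from δ (to (d j) z)) mx≡y) (δ⁻¹-on-Factor j y y∈supp))))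

      δ⁻¹Vδ⇒Orbit-U : Σ[ v ∈ Perm (Fin n) ] (V v × to ((invP δ ∘P v) ∘P δ) x ≡ y) → Orbit U x y
      δ⁻¹Vδ⇒Orbit-U (v , v∈V , δ⁻¹vδx≡y) =
        u , u∈U , trans (sym (agree x x∈supp)) (trans (sym (δ⁻¹-on-Factor j (to m x) mx∈supp)) δ⁻¹dmx≡y)
        where
          m'∈Vⱼ = proj₂ (Fⱼ.Vⱼ.Xⱼ-project v v∈V)
          m' = proj₁ (Fⱼ.Vⱼ.Xⱼ-project v v∈V)
          m = proj₁ (Fⱼ.Vⱼ⊆conj-d-Uⱼ m'∈Vⱼ)
          m∈Uⱼ = proj₁ (proj₂ (Fⱼ.Vⱼ⊆conj-d-Uⱼ m'∈Vⱼ))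
          m'≈dmd⁻¹ = proj₂ (proj₂ (Fⱼ.Vⱼ⊆conj-d-Uⱼ m'∈Vⱼ))
          u = proj₁ m∈Uⱼ
          u∈U = proj₁ (proj₂ m∈Uⱼ)
          agree = proj₂ (proj₂ (proj₂ m∈Uⱼ))
          mx∈supp = supp-closed Fin._≟_ (Factor≤ j) (Fⱼ.Uⱼ.Xⱼ⊆Factor m∈Uⱼ) x∈supp
          δ⁻¹dmx≡y : from δ (to (d j) (to m x)) ≡ y
          δ⁻¹dmx≡y = trans (cong (λ z → from δ (to (d j) (to m z))) (sym (from-to (d j) x)))
                     (trans (cong (from δ) (sym (m'≈dmd⁻¹ (to (d j) x))))
                     (trans (cong (from δ) (proj₂ (proj₂ (proj₂ m'∈Vⱼ)) (to (d j) x) dx∈supp))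
                     (trans (cong (λ z → from δ (to v z)) (sym (δ-on-Factor j x x∈supp))) δ⁻¹vδx≡y)))

lemma4p3 :
  (n : ℕ) (G : PSet (Fin n) lzero) → IsSubgroup G → Transitive G →
  (β : Fin n → Fin n) → IsNormalBlockSystem G β →
  (b₀ : Fin n) →
  -- N = Fix G β ,  T = Soc (Induced (Fix G β) β b₀)
  Transitive (Soc (Induced (Fix G β) β b₀)) →
  NonAbelian (Soc (Induced (Fix G β) β b₀)) →
  Simple (Soc (Induced (Fix G β) β b₀)) →
  -- (1) and (2)
  (Σ[ k ∈ ℕ ] Σ[ Ts ∈ (Fin k → PSet (Fin n) (lsuc lzero)) ]
    ( InternalDirectProduct (Soc (Fix G β)) Ts
    × (∀ i → Iso (Ts i) (Soc (Induced (Fix G β) β b₀)))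
    × IsIndexedBlockSystem G (λ i → supp (Ts i))
    × Refines β (λ i → supp (Ts i))
    × (∀ i (b : Fin n) → (∀ y → β y ≡ β b → supp (Ts i) y) →
         SameSet (PtStab (Fix G β) (λ y → β y ≡ β b))
                 (PtStab (Fix G β) (supp (Ts i))))
    × (∀ i → Trivial (λ g → PtStab (Fix G β) (supp (Ts i)) g × Ts i g))))
  -- (3)
  × (∀ (U V : PSet (Fin n) lzero) → IsSubgroup U → IsSubgroup V →
       U ⊆ Soc (Fix G β) → V ⊆ Soc (Fix G β) →
       Semiregular U → Semiregular V → Iso U V →
       (∀ (W₁ W₂ : PSet (Blk β b₀) lzero) → IsSubgroup W₁ → IsSubgroup W₂ →
          W₁ ⊆ Soc (Induced (Fix G β) β b₀) → W₂ ⊆ Soc (Induced (Fix G β) β b₀) →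
          Semiregular W₁ → Semiregular W₂ →
          Iso W₁ (Induced U β b₀) → Iso W₂ (Induced U β b₀) →
          ConjugateIn (Soc (Induced (Fix G β) β b₀)) W₁ W₂) →
       Σ[ δ ∈ Perm (Fin n) ] (Fix G β δ ×
         (∀ x y → (Σ[ u ∈ Perm (Fin n) ] (U u × to u x ≡ y))
            iff (Σ[ v ∈ Perm (Fin n) ] (V v × to ((invP δ ∘P v) ∘P δ) x ≡ y)))))
  -- (4)
  × (∀ g → Fix G β g →
       Soc (Fix G β) g iff
       (∀ (b : Fin n) → Σ[ σ ∈ Perm (Blk β b) ]
          (Restricts β b g σ × Soc (Induced (Fix G β) β b) σ)))
lemma4p3 n G G≤ G-transitive β β-normal b₀ T-transitive T-nonAbelian T-simple =
    ( k , Tᵢ , Soc-directProduct , Local.Tᵢ-Iso-T , supp-blockSystem , β-refines-supp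
    , PtStab-block≡PtStab-supp , PtStab-supp∩Tᵢ-trivial )
  , (λ U V U≤ V≤ U⊆Soc V⊆Soc U-semiregular V-semiregular U≅V conjugacy →
       let open Conjugation U V U≤ V≤ U⊆Soc V⊆Soc U-semiregular V-semiregular U≅V conjugacy in
       δ , δ∈N , λ x y → Orbit-U⇒δ⁻¹Vδ x y , δ⁻¹Vδ⇒Orbit-U x y)
  , Soc-iff-local
  where open Setting n G G≤ G-transitive β β-normal b₀ T-transitive T-nonAbelian T-simple
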